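{- $\mathcal{G}$ is a countable family of dense subsets of $\mathbb{P}$.
   Context: For each $k\in\mathbb{Z}$ let $\mathsf{c}_k$ be a distinct constant symbol, and $V^{\star}=\{\mathsf{c}_k:k\in\mathbb{Z}\}$. Let $\omega$ be the set of nonnegative integers and $\mathcal{X}$ the set of all $X\subseteq V^{\star}$ whose symmetric difference with $\{\mathsf{c}_k:k\in\omega\}$ is finite. Let $\mathbb{P}$ be the set of all partial one-to-one maps $\sigma$ from $V^{\star}$ to $\mathcal{X}$ (domain $\mathrm{dom}(\sigma)\subseteq V^{\star}$) such that (a) $u\in\sigma(u)$ for all $u\in\mathrm{dom}(\sigma)$, and (b) both $\bigcap\sigma[\mathrm{dom}(\sigma)]\setminus\mathrm{dom}(\sigma)$ and $V^{\star}\setminus\bigcup\sigma[\mathrm{dom}(\sigma)]$ are infinite. Write $\sigma\subseteq\tau$ iff $\sigma$ is a restriction of $\tau$. A set $D\subseteq\mathbb{P}$ is dense if for every $\sigma\in\mathbb{P}$ there is $\tau\in D$ with $\sigma\subseteq\tau$. For $\sigma\in\mathbb{P}$ and $x_0,\dots,x_n\in V^{\star}$, $\Delta(\sigma;x_0,\dots,x_n)$ is the smallest $W\subseteq V^{\star}$ such that: (1) $\{x_0,\dots,x_n\}\subseteq W$; (2) $\sigma(u)\setminus\sigma(v)\subseteq W$ for all $u,v\in W\cap\mathrm{dom}(\sigma)$; (3) if $v\in\mathrm{dom}(\sigma)$ and $\sigma(v)=(\sigma(u)\setminus A)\cup B$ for some $u\in W$ and finite $A,B\subseteq W$, then $v\in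 W$. The sequence $x_0,\dots,x_n$ is $\mathsf{Good}_1(\sigma)$ if (i) $\sigma$ is defined on all of $\Delta(\sigma;\vec{x})$, and (ii) for every $u\in\Delta(\sigma;\vec{x})$ and all finite $A,B\subseteq\Delta(\sigma;\vec{x})$ there is $v\in\Delta(\sigma;\vec{x})$ with $\sigma(v)=(\sigma(u)\setminus A)\cup B$. The relation $\in^{\sigma}$ on $V^{\star}$ is defined by $\mathsf{c}_i\in^{\sigma}\mathsf{c}_j$ iff $\mathsf{c}_j\in\mathrm{dom}(\sigma)$ and $\mathsf{c}_i\in\sigma(\mathsf{c}_j)$. A (possibly empty) sequence $(x_0,y_0),\dots,(x_m,y_m)$ of pairs of elements of $V^{\star}$ is $\mathsf{Good}_2(\sigma)$ if both $x_0,\dots,x_m$ and $y_0,\dots,y_m$ are $\mathsf{Good}_1(\sigma)$ and there is an isomorphism $f:(\Delta(\sigma;\vec{x}),\in^{\sigma})\to(\Delta(\sigma;\vec{y}),\in^{\sigma})$ (with $\in^{\sigma}$ restricted to these sets) such that $f(x_i)=y_i$ for all $i\le m$. For each finite (possibly empty) sequence $(a_0,b_0),\dots,(a_m,b_m)$ of pairs of elements of $V^{\star}$ and each $a_{m+1}\in V^{\star}$, let $\mathcal{G}((a_0,b_0),\dots,(a_m,b_m);a_{m+1})$ be the set of all $\sigma\in\mathbb{P}$ such that either (1) there exists $b_{m+1}\in V^{\star}$ with $(a_0,b_0),\dots,(a_m,b_m),(a_{m+1},b_{m+1})$ being $\mathsf{Good}_2(\sigma)$, or (2) there is no $\tau\in\mathbb{P}$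 with $\sigma\subseteq\tau$ such that $(a_0,b_0),\dots,(a_m,b_m)$ is $\mathsf{Good}_2(\tau)$. $\mathcal{G}$ is the family of all these sets $\mathcal{G}((a_0,b_0),\dots,(a_m,b_m);a_{m+1})$. -}

module Defs where

open import Data.Bool using (Bool; true; false; _xor_)
open import Data.Integer using (ℤ; +_; -[1+_])
open import Data.Nat using (ℕ)
open import Data.List using (List; []; _∷_; _++_; [_]; map)
open import Data.List.Membership.Propositional using (_∈_; _∉_)
open import Data.List.Relation.Unary.All using (All)
open import Data.Product using (Σ; ∃; ∃-syntax; _×_; _,_; proj₁; proj₂)
open import Data.Sum using (_⊎_)
open import Relation.Binary.PropositionalEquality using (_≡_)
open import Relation.Nullary using (¬_)
open import Relation.Unary using (Pred)
open import Function.Bundles using (_⇔_)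
open import Level using (0ℓ)

-- V⋆ = { c_k : k ∈ ℤ } is identified with ℤ via c_k ↦ k.
V : Set
V = ℤ

-- Subsets of V⋆, as characteristic functions (classical reading).
Subset : Set
Subset = V → Bool

_∋_ : Subset → V → Set
S ∋ x = S x ≡ true

_≗ₛ_ : Subset → Subset → Set
S ≗ₛ T = ∀ x → S x ≡ T x

ω : Subset
ω (+ _)      = true
ω -[1+ _ ]   = false

Finite : Pred V 0ℓ → Set
Finite P = ∃[ L ] (∀ x → P x → x ∈ L)

Infinite : Pred V 0ℓ → Set
Infinite P = ¬ Finite P

In𝒳 : Subset → Set
In𝒳 X = Finite (λ x → (X x xor ω x) ≡ true)

-- a partial map V⋆ ⇀ subsets: domain + values (values off the domain are ignored)
record PMap : Set where
  field
    dom : Subset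
    val : V → Subset
open PMap public

record Cond : Set where
  field
    σ       : PMap
    into𝒳   : ∀ u → dom σ ∋ u → In𝒳 (val σ u)
    inj     : ∀ u v → dom σ ∋ u → dom σ ∋ v → val σ u ≗ₛ val σ v → u ≡ v
    self    : ∀ u → dom σ ∋ u → val σ u ∋ u
    infCap  : Infinite (λ x → (∀ u → dom σ ∋ u → val σ u ∋ x) × dom σ x ≡ false)
    infCup  : Infinite (λ x → ∀ u → dom σ ∋ u → val σ u x ≡ false)
open Cond public

_⊑_ : Cond → Cond → Set
s ⊑ t = ∀ u → dom (σ s) ∋ u → (dom (σ t) ∋ u) × (val (σ s) u ≗ₛ val (σ t) u)

Dense : Pred Cond 0ℓ → Set
Dense D = ∀ s → ∃[ t ] (s ⊑ t × D t)

IsMod : Subset → Subset → List V → List V → Set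
IsMod T S A B = ∀ x → (T ∋ x ⇔ ((S ∋ x × x ∉ A) ⊎ x ∈ B))

data Δ (s : Cond) (xs : List V) : V → Set where
  base : ∀ {x} → x ∈ xs → Δ s xs x
  diff : ∀ {u v x} → Δ s xs u → Δ s xs v → dom (σ s) ∋ u → dom (σ s) ∋ v →
         val (σ s) u ∋ x → val (σ s) v x ≡ false → Δ s xs x
  gen  : ∀ {u v} (A B : List V) → Δ s xs u → All (Δ s xs) A → All (Δ s xs) B →
         dom (σ s) ∋ u → dom (σ s) ∋ v → IsMod (val (σ s) v) (val (σ s) u) A B →
         Δ s xs v

Good₁ : Cond → List V → Set
Good₁ s xs =
  (∀ x → Δ s xs x → dom (σ s) ∋ x) ×
  (∀ u (A B : List V) → Δ s xs u → All (Δ s xs) A → All (Δ s xs) B →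
     ∃[ v ] (Δ s xs v × IsMod (val (σ s) v) (val (σ s) u) A B))

_∈[_]_ : V → Cond → V → Set
i ∈[ s ] j = dom (σ s) ∋ j × val (σ s) j ∋ i

-- f : (Δ xs, ∈^σ) ≅ (Δ ys, ∈^σ), given by f with inverse g (off the sets: arbitrary)
IsIso : Cond → List V → List V → (V → V) → (V → V) → Set
IsIso s xs ys f g =
  (∀ a → Δ s xs a → Δ s ys (f a)) ×
  (∀ b → Δ s ys b → Δ s xs (g b)) ×
  (∀ a → Δ s xs a → g (f a) ≡ a) ×
  (∀ b → Δ s ys b → f (g b) ≡ b) ×
  (∀ a b → Δ s xs a → Δ s xs b → (a ∈[ s ] b ⇔ f a ∈[ s ] f b))

Good₂ : Cond → List (V × V) → Set
Good₂ s ps =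
  Good₁ s (map proj₁ ps) × Good₁ s (map proj₂ ps) ×
  ∃[ f ] ∃[ g ] (IsIso s (map proj₁ ps) (map proj₂ ps) f g ×
                 All (λ p → f (proj₁ p) ≡ proj₂ p) ps)

𝒢 : List (V × V) → V → Pred Cond 0ℓ
𝒢 ps a s = (∃[ b ] Good₂ s (ps ++ [ (a , b) ])) ⊎ ¬ (∃[ t ] (s ⊑ t × Good₂ t ps))

-- A family indexed by List (V × V) × V is countable through Cantor pairing. For density, let σ
-- be given; if no extension of σ makes the pairs Good₂, σ itself lies in 𝒢 by clause (2), so let
-- τ ⊒ σ make them Good₂ with isomorphism f. First extend τ to a condition whose domain is all of
-- V⋆ except two infinite reserves (points lying in every value, points lying in no value), the
-- new points being matched by back and forth with the still unused members of 𝒳. Then Δ-closures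
-- stay in the domain and every finite modification of a value is a value, so x⃗, a is Good₁.
-- Finally, extend f from Δ(x⃗) to Δ(x⃗, a) by sending each remaining point e to a fresh reserve
-- point that lies in the values exactly as e lies in σ(x₀), and give it the value of e transported
-- along the extended map (agreeing with σ(y₀) off its image). The extended map is then an
-- isomorphism Δ(x⃗, a) ≅ Δ(y⃗, f a).

module Submission where

open import Defs
open import Axiom.ExcludedMiddle using (ExcludedMiddle)
open import Axiom.DoubleNegationElimination using (em⇒dne)
open import Level using (0ℓ)
open import Data.Bool using (Bool; true; false; not; _∧_; _∨_; _xor_; if_then_else_)
open import Data.Bool.Properties using (⇔→≡; ∨-zeroʳ; ¬-not; xor-identityʳ; xor-same)
  renaming (_≟_ to _≟ᵇ_)
open import Data.Integer using (ℤ; +_; -[1+_]; ∣_∣)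
import Data.Integer.Properties as ℤ
open import Data.Nat using (ℕ; zero; suc; _+_; _*_; _≤_; _<_; z≤n; s≤s)
import Data.Nat.Properties as ℕ
open import Data.List using (List; []; _∷_; _++_; [_]; map; filter; upTo)
import Data.List.Properties as Listₚ
open import Data.List.Membership.Propositional using (_∈_; _∉_; find)
open import Data.List.Membership.Propositional.Properties
  using (∈-map⁺; ∈-map⁻; ∈-++⁺ˡ; ∈-++⁺ʳ; ∈-++⁻; ∈-filter⁺; ∈-filter⁻; ∈-upTo⁺)
open import Data.List.Membership.DecPropositional ℤ._≟_ using (_∈?_)
open import Data.List.Relation.Unary.Any using (here; there)
open import Data.List.Relation.Unary.All as All using (All; []; _∷_)
import Data.List.Relation.Unary.All.Properties as Allₚ
open import Data.Product using (Σ; ∃-syntax; Σ-syntax; _×_; _,_; proj₁; proj₂; uncurry)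
import Data.Product as Product
open import Data.Sum using (_⊎_; inj₁; inj₂; [_,_]′)
import Data.Sum as Sum
open import Data.Empty using (⊥-elim)
open import Function using (_∘_; id)
open import Function.Bundles using (mk⇔; Equivalence)
open import Relation.Binary using (tri<; tri≈; tri>)
open import Relation.Binary.PropositionalEquality
  using (_≡_; _≢_; refl; sym; trans; cong; cong₂; subst; subst₂; module ≡-Reasoning)
open import Relation.Nullary using (¬_; Dec; does; yes; no)
open import Relation.Nullary.Decidable using (_×-dec_; dec-true; dec-false; toSum)
open import Relation.Unary using (Pred; _≐_)
open Equivalence using (to; from)

true⇒¬false : ∀ {b} → b ≡ true → ¬ b ≡ false
true⇒¬false refl ()

Bool-ext : ∀ {a b : Bool} → (a ≡ true → b ≡ true) → (b ≡ true → a ≡ true) → a ≡ b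
Bool-ext f g = ⇔→≡ {z = true} (mk⇔ f g)

xor≡false⇒≡ : ∀ {a b} → a xor b ≡ false → a ≡ b
xor≡false⇒≡ {false} {false} _ = refl
xor≡false⇒≡ {true}  {true}  _ = refl

≗ₛ-sym : ∀ {S T} → S ≗ₛ T → T ≗ₛ S
≗ₛ-sym e x = sym (e x)

≗ₛ-trans : ∀ {S T U} → S ≗ₛ T → T ≗ₛ U → S ≗ₛ U
≗ₛ-trans e f x = trans (e x) (f x)

In𝒳-resp : ∀ {T T′} → T ≗ₛ T′ → In𝒳 T → In𝒳 T′
In𝒳-resp e (L , covers) = L , λ z d → covers z (subst (λ b → b xor ω z ≡ true) (sym (e z)) d)

In𝒳-agrees-ω : ∀ {T} (c : In𝒳 T) {z} → z ∉ proj₁ c → T z ≡ ω z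
In𝒳-agrees-ω {T} (L , h) {z} z∉L with T z | ω z | h z
... | false | false | _ = refl
... | true  | true  | _ = refl
... | false | true  | c = ⊥-elim (z∉L (c refl))
... | true  | false | c = ⊥-elim (z∉L (c refl))

ω-In𝒳 : In𝒳 ω
ω-In𝒳 = [] , λ z d → ⊥-elim (true⇒¬false d (xor-same (ω z)))

In𝒳-differences : ∀ {S T} (cS : In𝒳 S) (cT : In𝒳 T) {z} → S z ≢ T z → z ∈ proj₁ cS ++ proj₁ cT
In𝒳-differences {S} {T} cS cT {z} S≢T with z ∈? proj₁ cS | z ∈? proj₁ cT
... | yes z∈ | _      = ∈-++⁺ˡ z∈
... | no _   | yes z∈ = ∈-++⁺ʳ (proj₁ cS) z∈
... | no z∉  | no z∉′ = ⊥-elim (S≢T (trans (In𝒳-agrees-ω {S} cS z∉) (sym (In𝒳-agrees-ω {T} cT z∉′))))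

exceptions : ∀ {Ts} → All In𝒳 Ts → List V
exceptions []       = []
exceptions (c ∷ cs) = proj₁ c ++ exceptions cs

exceptions-agree-ω : ∀ {Ts} (cs : All In𝒳 Ts) {z} → z ∉ exceptions cs → All (λ T → T z ≡ ω z) Ts
exceptions-agree-ω []                   _    = []
exceptions-agree-ω (_∷_ {x = T} c cs) z∉ =
  In𝒳-agrees-ω {T} c (z∉ ∘ ∈-++⁺ˡ) ∷ exceptions-agree-ω cs (z∉ ∘ ∈-++⁺ʳ (proj₁ c))

-- Finite modifications

IsMod-resp : ∀ {T T′ S S′ A B} → T ≗ₛ T′ → S ≗ₛ S′ → IsMod T S A B → IsMod T′ S′ A B
IsMod-resp e₁ e₂ m x = mk⇔
  (λ h → Sum.map₁ (Product.map₁ (trans (sym (e₂ x)))) (to (m x) (trans (e₁ x) h)))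
  (λ h → trans (sym (e₁ x)) (from (m x) (Sum.map₁ (Product.map₁ (trans (e₂ x))) h)))

IsMod-unique : ∀ {T T′ S A B} → IsMod T S A B → IsMod T′ S A B → T ≗ₛ T′
IsMod-unique m m′ x = Bool-ext (from (m′ x) ∘ to (m x)) (from (m x) ∘ to (m′ x))

IsMod-outside : ∀ {T S A B z} → IsMod T S A B → z ∉ A → z ∉ B → T z ≡ S z
IsMod-outside {z = z} m z∉A z∉B = Bool-ext
  ([ proj₁ , (λ z∈B → ⊥-elim (z∉B z∈B)) ]′ ∘ to (m z))
  (λ h → from (m z) (inj₁ (h , z∉A)))

IsMod-keeps : ∀ {T S A B z} → IsMod T S A B → S ∋ z → z ∉ A → T ∋ z
IsMod-keeps {z = z} m z∈S z∉A = from (m z) (inj₁ (z∈S , z∉A))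

IsMod-avoids : ∀ {T S A B z} → IsMod T S A B → S z ≡ false → z ∉ B → T z ≡ false
IsMod-avoids {z = z} m z∉S z∉B = ¬-not λ z∈T →
  [ (λ (z∈S , _) → true⇒¬false z∈S z∉S) , z∉B ]′ (to (m z) z∈T)

modify : Subset → List V → List V → Subset
modify S A B z = (S z ∧ not (does (z ∈? A))) ∨ does (z ∈? B)

IsMod-modify : ∀ S A B → IsMod (modify S A B) S A B
IsMod-modify S A B x with S x | x ∈? A | x ∈? B
... | _     | _       | yes x∈B = mk⇔ (λ _ → inj₂ x∈B) (λ _ → ∨-zeroʳ _)
... | true  | no x∉A  | no x∉B  = mk⇔ (λ _ → inj₁ (refl , x∉A)) (λ _ → refl)
... | true  | yes x∈A | no x∉B  =
      mk⇔ (λ ()) [ (λ (_ , x∉A) → ⊥-elim (x∉A x∈A)) , (λ x∈B → ⊥-elim (x∉B x∈B)) ]′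
... | false | _       | no x∉B  = mk⇔ (λ ()) [ (λ ()) ∘ proj₁ , (λ x∈B → ⊥-elim (x∉B x∈B)) ]′

modify-adds : ∀ {S A B z} → z ∈ B → modify S A B ∋ z
modify-adds {S} {A} {B} {z} z∈B = from (IsMod-modify S A B z) (inj₂ z∈B)

modify-removes : ∀ {S A B z} → z ∈ A → z ∉ B → modify S A B z ≡ false
modify-removes {S} {A} {B} {z} z∈A z∉B = ¬-not λ z∈T →
  [ (λ (_ , z∉A) → z∉A z∈A) , z∉B ]′ (to (IsMod-modify S A B z) z∈T)

modify-In𝒳 : ∀ {S} A B → In𝒳 S → In𝒳 (modify S A B)
modify-In𝒳 {S} A B (L , L-covers) = L ++ A ++ B , covers
  where
  covers : ∀ z → (modify S A B z xor ω z) ≡ true → z ∈ L ++ A ++ B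
  covers z d = by-cases (z ∈? A) (z ∈? B)
    where
    by-cases : Dec (z ∈ A) → Dec (z ∈ B) → z ∈ L ++ A ++ B
    by-cases (yes z∈A) _         = ∈-++⁺ʳ L (∈-++⁺ˡ z∈A)
    by-cases (no _)    (yes z∈B) = ∈-++⁺ʳ L (∈-++⁺ʳ A z∈B)
    by-cases (no z∉A)  (no z∉B)  = ∈-++⁺ˡ (L-covers z
      (subst (λ b → b xor ω z ≡ true) (IsMod-outside (IsMod-modify S A B) z∉A z∉B) d))

differences-IsMod : ∀ T S (L : List V) → (∀ z → T z ≢ S z → z ∈ L) →
  ∃[ A ] ∃[ B ] (All (λ z → T z ≢ S z) A × All (λ z → T z ≢ S z) B × IsMod T S A B)
differences-IsMod T S L covers =
  filter removed? L , filter added? L ,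
  All.tabulate (λ z∈ → differs (proj₂ (∈-filter⁻ removed? {xs = L} z∈))) ,
  All.tabulate (λ z∈ → differs′ (proj₂ (∈-filter⁻ added? {xs = L} z∈))) ,
  isMod
  where
  removed? : ∀ z → Dec (S z ≡ true × T z ≡ false)
  removed? z = (S z ≟ᵇ true) ×-dec (T z ≟ᵇ false)
  added? : ∀ z → Dec (T z ≡ true × S z ≡ false)
  added? z = (T z ≟ᵇ true) ×-dec (S z ≟ᵇ false)
  differs : ∀ {z} → S z ≡ true × T z ≡ false → T z ≢ S z
  differs (s , t) e = true⇒¬false s (trans (sym e) t)
  differs′ : ∀ {z} → T z ≡ true × S z ≡ false → T z ≢ S z
  differs′ (t , s) e = true⇒¬false t (trans e s)
  isMod : IsMod T S (filter removed? L) (filter added? L)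
  isMod z = mk⇔ to′ from′
    where
    to′ : T ∋ z → (S ∋ z × z ∉ filter removed? L) ⊎ z ∈ filter added? L
    to′ t with S z in es
    ... | true  = inj₁ (refl , λ z∈ → true⇒¬false t (proj₂ (proj₂ (∈-filter⁻ removed? {xs = L} z∈))))
    ... | false = inj₂ (∈-filter⁺ added? (covers z (differs′ (t , es))) (t , es))
    from′ : (S ∋ z × z ∉ filter removed? L) ⊎ z ∈ filter added? L → T ∋ z
    from′ (inj₂ z∈) = proj₁ (proj₂ (∈-filter⁻ added? {xs = L} z∈))
    from′ (inj₁ (s , z∉)) with T z in et
    ... | true  = refl
    ... | false = ⊥-elim (z∉ (∈-filter⁺ removed? (covers z (differs (s , et))) (s , et)))

-- Conditions and Δ

Dom : Cond → V → Set
Dom s u = dom (σ s) ∋ u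

Val : Cond → V → Subset
Val s = val (σ s)

dom-cases : ∀ s u → Dom s u ⊎ dom (σ s) u ≡ false
dom-cases s u with dom (σ s) u
... | true  = inj₁ refl
... | false = inj₂ refl

⊑-refl : ∀ s → s ⊑ s
⊑-refl s u d = d , λ _ → refl

⊑-trans : ∀ {s t w} → s ⊑ t → t ⊑ w → s ⊑ w
⊑-trans s⊑t t⊑w u d =
  let d′ , e = s⊑t u d ; d″ , e′ = t⊑w u d′ in d″ , ≗ₛ-trans e e′

module _ (s : Cond) (L : List V) (Q : V → Set)
  (base* : ∀ {x} → x ∈ L → Q x)
  (diff* : ∀ {u v x} → Q u → Q v → Dom s u → Dom s v → Val s u ∋ x → Val s v x ≡ false → Q x)
  (gen* : ∀ {u v} (A B : List V) → Q u → All Q A → All Q B → Dom s u → Dom s v →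
          IsMod (Val s v) (Val s u) A B → Q v) where

  Δ-ind : ∀ {x} → Δ s L x → Q x
  Δ-ind-All : ∀ {A} → All (Δ s L) A → All Q A
  Δ-ind (base x∈L) = base* x∈L
  Δ-ind (diff du dv u∈ v∈ x∈u x∉v) = diff* (Δ-ind du) (Δ-ind dv) u∈ v∈ x∈u x∉v
  Δ-ind (gen A B du dA dB u∈ v∈ m) = gen* A B (Δ-ind du) (Δ-ind-All dA) (Δ-ind-All dB) u∈ v∈ m
  Δ-ind-All [] = []
  Δ-ind-All (d ∷ ds) = Δ-ind d ∷ Δ-ind-All ds

Δ-mono : ∀ {s L L′} → (∀ {x} → x ∈ L → x ∈ L′) → ∀ {x} → Δ s L x → Δ s L′ x
Δ-mono {s} {L} {L′} L⊆L′ = Δ-ind s L (Δ s L′) (base ∘ L⊆L′) diff gen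

Δ-⊑ : ∀ {s t L} → s ⊑ t → ∀ {x} → Δ s L x → Δ t L x
Δ-⊑ {s} {t} {L} s⊑t = Δ-ind s L (Δ t L) base
  (λ {u} {v} {x} du dv u∈ v∈ x∈u x∉v →
     diff du dv (proj₁ (s⊑t u u∈)) (proj₁ (s⊑t v v∈))
       (trans (sym (proj₂ (s⊑t u u∈) x)) x∈u) (trans (sym (proj₂ (s⊑t v v∈) x)) x∉v))
  (λ {u} {v} A B du dA dB u∈ v∈ m →
     gen A B du dA dB (proj₁ (s⊑t u u∈)) (proj₁ (s⊑t v v∈))
       (IsMod-resp (proj₂ (s⊑t v v∈)) (proj₂ (s⊑t u u∈)) m))

-- A modification met in the extension is already realised in Δ, by the same point
-- (injectivity).
Δ-⊑-reflect : ∀ {s t L} → s ⊑ t → Good₁ s L → ∀ {x} → Δ t L x → Δ s L x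
Δ-⊑-reflect {s} {t} {L} s⊑t (inDom , closed) = Δ-ind t L (Δ s L) base
  (λ {u} {v} {x} du dv _ _ x∈u x∉v →
     let u∈ = inDom u du ; v∈ = inDom v dv in
     diff du dv u∈ v∈ (trans (proj₂ (s⊑t u u∈) x) x∈u) (trans (proj₂ (s⊑t v v∈) x) x∉v))
  (λ {u} {v} A B du dA dB _ v∈ m →
     let w , dw , mw = closed u A B du dA dB
         w∈ = inDom w dw
         mw′ = IsMod-resp (proj₂ (s⊑t w w∈)) (proj₂ (s⊑t u (inDom u du))) mw
     in subst (Δ s L) (sym (inj t v w v∈ (proj₁ (s⊑t w w∈)) (IsMod-unique m mw′))) dw)

Good₁-⊑ : ∀ {s t L} → s ⊑ t → Good₁ s L → Good₁ t L
Good₁-⊑ {s} {t} {L} s⊑t G@(inDom , closed) =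
  (λ x d → proj₁ (s⊑t x (inDom x (back d)))) ,
  (λ u A B du dA dB →
     let du′ = back du
         v , dv , mv = closed u A B du′ (All.map back dA) (All.map back dB)
     in v , Δ-⊑ s⊑t dv ,
        IsMod-resp (proj₂ (s⊑t v (inDom v dv))) (proj₂ (s⊑t u (inDom u du′))) mv)
  where
  back : ∀ {x} → Δ t L x → Δ s L x
  back = Δ-⊑-reflect s⊑t G

Δ-values-agree : ∀ {s L u v x} → Dom s u → Dom s v → Δ s L u → Δ s L v → ¬ Δ s L x →
                 Val s u x ≡ Val s v x
Δ-values-agree {s} {L} {u} {v} {x} u∈ v∈ du dv x∉Δ with Val s u x in eu | Val s v x in ev
... | true  | true  = refl
... | false | false = refl
... | true  | false = ⊥-elim (x∉Δ (diff du dv u∈ v∈ eu ev))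
... | false | true  = ⊥-elim (x∉Δ (diff dv du v∈ u∈ ev eu))

Closed : Cond → Set
Closed t =
  (∀ {u v x} → Dom t u → Dom t v → Val t u ∋ x → Val t v x ≡ false → Dom t x) ×
  (∀ u A B → Dom t u → All (Dom t) A → All (Dom t) B →
     ∃[ v ] (Dom t v × IsMod (Val t v) (Val t u) A B))

Closed⇒Good₁ : ∀ {t L} → Closed t → (∀ {x} → x ∈ L → Dom t x) → Good₁ t L
Closed⇒Good₁ {t} {L} (diff-closed , mod-closed) L⊆dom =
  (λ _ → inDom) ,
  (λ u A B du dA dB →
     let v , v∈ , m = mod-closed u A B (inDom du) (All.map inDom dA) (All.map inDom dB)
     in v , gen A B du dA dB (inDom du) v∈ m , m)
  where
  inDom : ∀ {x} → Δ t L x → Dom t x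
  inDom = Δ-ind t L (Dom t) L⊆dom (λ _ _ → diff-closed) (λ _ _ _ _ _ _ v∈ _ → v∈)

-- Countability

Onto : {A B : Set} → (A → B) → Set
Onto f = ∀ b → ∃[ a ] (f a ≡ b)

Onto-∘ : {A B C : Set} {f : B → C} {g : A → B} → Onto f → Onto g → Onto (f ∘ g)
Onto-∘ {f = f} f-onto g-onto c =
  let b , fb≡c = f-onto c ; a , ga≡b = g-onto b in a , trans (cong f ga≡b) fb≡c

Onto-× : {A B C D : Set} {f : A → B} {g : C → D} → Onto f → Onto g → Onto (Product.map f g)
Onto-× f-onto g-onto (b , d) =
  let a , fa≡b = f-onto b ; c , gc≡d = g-onto d in (a , c) , cong₂ _,_ fa≡b gc≡d

-- Cantor's enumeration of ℕ × ℕ, walking each antidiagonal from (0 , j) down to (j , 0).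
next : ℕ × ℕ → ℕ × ℕ
next (i , zero)  = 0 , suc i
next (i , suc j) = suc i , j

unpair : ℕ → ℕ × ℕ
unpair zero    = 0 , 0
unpair (suc n) = next (unpair n)

unpair-walk : ∀ m {n i j} → unpair n ≡ (i , j + m) → unpair (m + n) ≡ (i + m , j)
unpair-walk zero {n} {i} {j} eq = trans eq (cong₂ _,_ (sym (ℕ.+-identityʳ i)) (ℕ.+-identityʳ j))
unpair-walk (suc m) {n} {i} {j} eq = begin
  unpair (suc m + n)  ≡⟨ cong unpair (sym (ℕ.+-suc m n)) ⟩
  unpair (m + suc n)  ≡⟨ unpair-walk m step ⟩
  (suc i + m , j)     ≡⟨ cong (_, j) (sym (ℕ.+-suc i m)) ⟩
  (i + suc m , j)     ∎
  where
  open ≡-Reasoning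
  step : unpair (suc n) ≡ (suc i , j + m)
  step rewrite eq | ℕ.+-suc j m = refl

unpair-onto : Onto unpair
unpair-onto (i , j) = let n , eq = antidiagonal (j + i) in i + n , unpair-walk i eq
  where
  antidiagonal : ∀ k → ∃[ n ] (unpair n ≡ (0 , k))
  antidiagonal zero = 0 , refl
  antidiagonal (suc k) = let n , eq = antidiagonal k in suc (k + n) , cong next (unpair-walk k eq)

fromSigned : ℕ × ℕ → ℤ
fromSigned (zero  , j) = + j
fromSigned (suc _ , j) = -[1+ j ]

fromSigned-onto : Onto fromSigned
fromSigned-onto (+ j)     = (0 , j) , refl
fromSigned-onto -[1+ j ]  = (1 , j) , refl

-- A list is coded by its length and a code for its entries.
decodeList : {A : Set} → (ℕ → A) → ℕ → ℕ → List A
decodeList e zero    c = []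
decodeList e (suc k) c = let i , c′ = unpair c in e i ∷ decodeList e k c′

decodeList-onto : {A : Set} {e : ℕ → A} → Onto e → Onto (uncurry (decodeList e))
decodeList-onto e-onto [] = (0 , 0) , refl
decodeList-onto {e = e} e-onto (x ∷ xs) =
  let i , ei≡x = e-onto x
      (k , c′) , eq = decodeList-onto e-onto xs
      c , c≡ = unpair-onto (i , c′)
  in (suc k , c) , subst (λ p → e (proj₁ p) ∷ decodeList e k (proj₂ p) ≡ x ∷ xs) (sym c≡)
                       (cong₂ _∷_ ei≡x eq)

enumℤ : ℕ → ℤ
enumℤ = fromSigned ∘ unpair

enumℤ-onto : Onto enumℤ
enumℤ-onto = Onto-∘ fromSigned-onto unpair-onto

enumList : ℕ → List ℤ
enumList = uncurry (decodeList enumℤ) ∘ unpair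

enum𝒳 : ℕ → Subset
enum𝒳 n z = ω z xor does (z ∈? enumList n)

enum𝒳-onto : ∀ {T} → In𝒳 T → ∃[ n ] (enum𝒳 n ≗ₛ T)
enum𝒳-onto {T} (L , L-covers) =
  let n , eq = Onto-∘ (decodeList-onto enumℤ-onto) unpair-onto (filter differs? L)
  in n , λ z → subst (λ E → ω z xor does (z ∈? E) ≡ T z) (sym eq) (pointwise z)
  where
  differs? : ∀ z → Dec ((T z xor ω z) ≡ true)
  differs? z = (T z xor ω z) ≟ᵇ true
  pointwise : ∀ z → ω z xor does (z ∈? filter differs? L) ≡ T z
  pointwise z with z ∈? filter differs? L
  ... | yes z∈ = flip (proj₂ (∈-filter⁻ differs? {xs = L} z∈))
    where
    flip : T z xor ω z ≡ true → ω z xor true ≡ T z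
    flip with T z | ω z
    ... | true  | false = λ _ → refl
    ... | false | true  = λ _ → refl
    ... | true  | true  = λ ()
    ... | false | false = λ ()
  ... | no z∉ = trans (xor-identityʳ (ω z))
                  (sym (xor≡false⇒≡ (¬-not λ d → z∉ (∈-filter⁺ differs? (L-covers z d) d))))

enum𝒢-index : ℕ → List (V × V) × V
enum𝒢-index =
  Product.map (uncurry (decodeList (Product.map enumℤ enumℤ ∘ unpair)) ∘ unpair) enumℤ ∘ unpair

enum𝒢-index-onto : Onto enum𝒢-index
enum𝒢-index-onto =
  Onto-∘ (Onto-× (Onto-∘ (decodeList-onto (Onto-∘ (Onto-× enumℤ-onto enumℤ-onto) unpair-onto))
                         unpair-onto)
                 enumℤ-onto)
         unpair-onto

𝒢-countable : Σ[ e ∈ (ℕ → Pred Cond 0ℓ) ]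
  ((∀ n → ∃[ ps ] ∃[ a ] (e n ≐ 𝒢 ps a)) ×
   (∀ (ps : List (V × V)) (a : V) → ∃[ n ] (e n ≐ 𝒢 ps a)))
𝒢-countable = uncurry 𝒢 ∘ enum𝒢-index ,
  (λ n → proj₁ (enum𝒢-index n) , proj₂ (enum𝒢-index n) , id , id) ,
  (λ ps a → let n , eq = enum𝒢-index-onto (ps , a) in
            n , subst (λ i → uncurry 𝒢 i ≐ 𝒢 ps a) (sym eq) (id , id))

StrictlyIncreasing : (ℕ → ℕ) → Set
StrictlyIncreasing f = ∀ {m n} → m < n → f m < f n

module _ {f : ℕ → ℕ} (f-inc : StrictlyIncreasing f) where

  strictlyIncreasing-injective : ∀ {m n} → f m ≡ f n → m ≡ n
  strictlyIncreasing-injective {m} {n} eq with ℕ.<-cmp m n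
  ... | tri< m<n _ _ = ⊥-elim (ℕ.<⇒≢ (f-inc m<n) eq)
  ... | tri≈ _ m≡n _ = m≡n
  ... | tri> _ _ n<m = ⊥-elim (ℕ.<⇒≢ (f-inc n<m) (sym eq))

  strictlyIncreasing-inflationary : ∀ n → n ≤ f n
  strictlyIncreasing-inflationary zero    = z≤n
  strictlyIncreasing-inflationary (suc n) =
    ℕ.≤-<-trans (strictlyIncreasing-inflationary n) (f-inc (ℕ.n<1+n n))

  even≢odd-values : ∀ m n → f (2 * m) ≢ f (suc (2 * n))
  even≢odd-values m n = ℕ.even≢odd m n ∘ strictlyIncreasing-injective

strictlyIncreasing-suc : ∀ {f} → (∀ n → f n < f (suc n)) → StrictlyIncreasing f
strictlyIncreasing-suc step {m} {suc n} (s≤s m≤n) with ℕ.m≤n⇒m<n∨m≡n m≤n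
... | inj₁ m<n  = ℕ.<-trans (strictlyIncreasing-suc step m<n) (step n)
... | inj₂ refl = step n

StrictlyIncreasing-∘ : ∀ {f g} → StrictlyIncreasing f → StrictlyIncreasing g → StrictlyIncreasing (f ∘ g)
StrictlyIncreasing-∘ f-inc g-inc = f-inc ∘ g-inc

2*-strictlyIncreasing : StrictlyIncreasing (2 *_)
2*-strictlyIncreasing = ℕ.*-monoʳ-< 2

1+2*-strictlyIncreasing : StrictlyIncreasing (suc ∘ (2 *_))
1+2*-strictlyIncreasing = s≤s ∘ 2*-strictlyIncreasing

Unbounded : (ℕ → Set) → Set
Unbounded Q = ∀ b → ∃[ m ] (b < m × Q m)

module Enumeration {Q : ℕ → Set} (unbounded : Unbounded Q) (b : ℕ) where

  nth : ℕ → ℕ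
  nth zero    = proj₁ (unbounded b)
  nth (suc n) = proj₁ (unbounded (nth n))

  nth-satisfies : ∀ n → Q (nth n)
  nth-satisfies zero    = proj₂ (proj₂ (unbounded b))
  nth-satisfies (suc n) = proj₂ (proj₂ (unbounded (nth n)))

  nth-strictlyIncreasing : StrictlyIncreasing nth
  nth-strictlyIncreasing = strictlyIncreasing-suc (λ n → proj₁ (proj₂ (unbounded (nth n))))

  bound<nth : ∀ n → b < nth n
  bound<nth zero    = proj₁ (proj₂ (unbounded b))
  bound<nth (suc n) = ℕ.<-trans (bound<nth n) (nth-strictlyIncreasing (ℕ.n<1+n n))

encodeℤ : ℤ → ℕ
encodeℤ (+ n)     = 2 * n
encodeℤ -[1+ n ]  = suc (2 * n)

encodeℤ-injective : ∀ {x y} → encodeℤ x ≡ encodeℤ y → x ≡ y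
encodeℤ-injective {+ m}      {+ n}      eq = cong +_ (ℕ.*-cancelˡ-≡ m n 2 eq)
encodeℤ-injective {+ m}      { -[1+ n ]} eq = ⊥-elim (ℕ.even≢odd m n eq)
encodeℤ-injective { -[1+ m ]} {+ n}      eq = ⊥-elim (ℕ.even≢odd n m (sym eq))
encodeℤ-injective { -[1+ m ]} { -[1+ n ]} eq =
  cong -[1+_] (ℕ.*-cancelˡ-≡ m n 2 (ℕ.suc-injective eq))

size : List ℤ → ℕ
size []      = 0
size (z ∷ L) = ∣ z ∣ + size L

∣∣≤size : ∀ {z L} → z ∈ L → ∣ z ∣ ≤ size L
∣∣≤size {z} {_ ∷ L} (here refl) = ℕ.m≤m+n ∣ z ∣ (size L)
∣∣≤size {L = y ∷ L} (there z∈L) = ℕ.≤-trans (∣∣≤size z∈L) (ℕ.m≤n+m (size L) ∣ y ∣)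

∉upTo⇒> : ∀ {b m} → m ∉ upTo (suc b) → b < m
∉upTo⇒> m∉ = ℕ.≰⇒> (m∉ ∘ ∈-upTo⁺ ∘ s≤s)

+∉ : ∀ {L n} → size L < n → + n ∉ L
+∉ lt = ℕ.<⇒≱ lt ∘ ∣∣≤size

-[1+]∉ : ∀ {L n} → size L ≤ n → -[1+ n ] ∉ L
-[1+]∉ le = ℕ.<⇒≱ (s≤s le) ∘ ∣∣≤size

module _ {f : ℕ → ℕ} (f-inc : StrictlyIncreasing f) (L : List ℤ) where

  +-beyond∉ : + f (suc (size L)) ∉ L
  +-beyond∉ = +∉ (strictlyIncreasing-inflationary f-inc (suc (size L)))

  -[1+]-beyond∉ : -[1+ f (size L) ] ∉ L
  -[1+]-beyond∉ = -[1+]∉ (strictlyIncreasing-inflationary f-inc (size L))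

module _ {f : ℕ → ℕ} (f-inc : StrictlyIncreasing f) {Q : V → Set} where

  +-image-Infinite : (∀ n → Q (+ f n)) → Infinite Q
  +-image-Infinite q (L , covers) = +-beyond∉ f-inc L (covers _ (q _))

  -[1+]-image-Infinite : (∀ n → Q -[1+ f n ]) → Infinite Q
  -[1+]-image-Infinite q (L , covers) = -[1+]-beyond∉ f-inc L (covers _ (q _))

module Classical (em : ExcludedMiddle 0ℓ) where

  ⌊_⌋ : Set → Bool
  ⌊ P ⌋ = does (em {P})

  ⌊⌋-true : ∀ {P} → P → ⌊ P ⌋ ≡ true
  ⌊⌋-true = dec-true em

  ⌊⌋-false : ∀ {P} → ¬ P → ⌊ P ⌋ ≡ false
  ⌊⌋-false = dec-false em

  decide : (P : Set) → P ⊎ ¬ P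
  decide P = toSum em

  dne : ∀ {P : Set} → ¬ ¬ P → P
  dne = em⇒dne em

  Infinite⇒fresh : ∀ {Q : V → Set} → Infinite Q → ∀ L → ∃[ x ] (Q x × x ∉ L)
  Infinite⇒fresh inf L = dne λ none → inf (L , λ x qx → dne λ x∉L → none (x , qx , x∉L))

  ¬All¬⇒∃ : ∀ {A : Set} {Q : A → Set} (L : List A) → ¬ All (λ y → ¬ Q y) L → ∃[ y ] (y ∈ L × Q y)
  ¬All¬⇒∃ L h = find (dne λ ¬any → h (Allₚ.¬Any⇒All¬ L ¬any))

-- Back and forth along the enumerations of V and of 𝒳 builds a bijection x ↦ f x between
-- the points satisfying P and the subsets satisfying U (up to ≗ₛ) with R x (f x).
module BackAndForth (em : ExcludedMiddle 0ℓ)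
  (P : V → Set) (U : Subset → Set) (R : V → Subset → Set)
  (U⇒In𝒳 : ∀ {T} → U T → In𝒳 T)
  (U-resp : ∀ {T T′} → T ≗ₛ T′ → U T → U T′)
  (forth : ∀ x → P x → (Ts : List Subset) → All U Ts →
           ∃[ T ] (U T × R x T × All (λ T′ → ¬ T ≗ₛ T′) Ts))
  (back : ∀ T → U T → (xs : List V) → ∃[ x ] (P x × R x T × x ∉ xs)) where

  open Classical em

  Eligible : V × Subset → Set
  Eligible (x , T) = P x × U T × R x T

  Functional : List (V × Subset) → Set
  Functional L = ∀ {p p′} → p ∈ L → p′ ∈ L →
    (proj₁ p ≡ proj₁ p′ → proj₂ p ≗ₛ proj₂ p′) × (proj₂ p ≗ₛ proj₂ p′ → proj₁ p ≡ proj₁ p′)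

  Matching : Set
  Matching = Σ (List (V × Subset)) λ L → All Eligible L × Functional L

  pairs : Matching → List (V × Subset)
  pairs = proj₁

  values-U : ∀ L → All Eligible L → All U (map proj₂ L)
  values-U []      []                  = []
  values-U (_ ∷ L) ((_ , u , _) ∷ gs) = u ∷ values-U L gs

  snoc : (M : Matching) → ∀ x T → Eligible (x , T) → x ∉ map proj₁ (pairs M) →
         All (λ T′ → ¬ T ≗ₛ T′) (map proj₂ (pairs M)) → Matching
  snoc (L , goods , fun) x T g x-new T-new = L ++ [ (x , T) ] , Allₚ.++⁺ goods (g ∷ []) , fun′
    where
    fun′ : Functional (L ++ [ (x , T) ])
    fun′ m m′ with ∈-++⁻ L m | ∈-++⁻ L m′
    ... | inj₁ a           | inj₁ b           = fun a b
    ... | inj₁ a           | inj₂ (here refl) =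
          (λ e → ⊥-elim (x-new (subst (_∈ map proj₁ L) e (∈-map⁺ proj₁ a)))) ,
          (λ e → ⊥-elim (All.lookup T-new (∈-map⁺ proj₂ a) (≗ₛ-sym e)))
    ... | inj₂ (here refl) | inj₁ b           =
          (λ e → ⊥-elim (x-new (subst (_∈ map proj₁ L) (sym e) (∈-map⁺ proj₁ b)))) ,
          (λ e → ⊥-elim (All.lookup T-new (∈-map⁺ proj₂ b) e))
    ... | inj₂ (here refl) | inj₂ (here refl) = (λ _ _ → refl) , (λ _ → refl)

  forthStep : Matching → ℕ → Matching
  forthStep M@(L , goods , _) n with em {P (enumℤ n) × enumℤ n ∉ map proj₁ L}
  ... | no _ = M
  ... | yes (px , x-new) =
    let T , uT , rT , T-new = forth (enumℤ n) px (map proj₂ L) (values-U L goods)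
    in snoc M (enumℤ n) T (px , uT , rT) x-new T-new

  backStep : Matching → ℕ → Matching
  backStep M@(L , _) n with em {U (enum𝒳 n) × All (λ T′ → ¬ enum𝒳 n ≗ₛ T′) (map proj₂ L)}
  ... | no _ = M
  ... | yes (uT , T-new) =
    let x , px , rx , x-new = back (enum𝒳 n) uT (map proj₁ L)
    in snoc M x (enum𝒳 n) (px , uT , rx) x-new T-new

  stage : ℕ → Matching
  stage zero    = [] , [] , λ ()
  stage (suc n) = backStep (forthStep (stage n) n) n

  forthStep-⊇ : ∀ M n {p} → p ∈ pairs M → p ∈ pairs (forthStep M n)
  forthStep-⊇ (L , _) n m with em {P (enumℤ n) × enumℤ n ∉ map proj₁ L}
  ... | no _  = m
  ... | yes _ = ∈-++⁺ˡ m

  backStep-⊇ : ∀ M n {p} → p ∈ pairs M → p ∈ pairs (backStep M n)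
  backStep-⊇ (L , _) n m with em {U (enum𝒳 n) × All (λ T′ → ¬ enum𝒳 n ≗ₛ T′) (map proj₂ L)}
  ... | no _  = m
  ... | yes _ = ∈-++⁺ˡ m

  stage-⊆ : ∀ m k {p} → p ∈ pairs (stage m) → p ∈ pairs (stage (k + m))
  stage-⊆ m zero    p∈ = p∈
  stage-⊆ m (suc k) p∈ = backStep-⊇ _ (k + m) (forthStep-⊇ _ (k + m) (stage-⊆ m k p∈))

  -- Two pairs occurring at some stages both occur at a common later stage.
  functional : ∀ {p p′} → ∃[ m ] (p ∈ pairs (stage m)) → ∃[ n ] (p′ ∈ pairs (stage n)) →
    (proj₁ p ≡ proj₁ p′ → proj₂ p ≗ₛ proj₂ p′) × (proj₂ p ≗ₛ proj₂ p′ → proj₁ p ≡ proj₁ p′)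
  functional {p} {p′} (m , p∈) (n , p′∈) =
    proj₂ (proj₂ (stage (n + m))) (stage-⊆ m n p∈)
      (subst (λ k → p′ ∈ pairs (stage k)) (ℕ.+-comm m n) (stage-⊆ n m p′∈))

  forthStep-covers : ∀ M n → P (enumℤ n) → ∃[ T ] ((enumℤ n , T) ∈ pairs (forthStep M n))
  forthStep-covers (L , _) n px with em {P (enumℤ n) × enumℤ n ∉ map proj₁ L}
  ... | yes _ = _ , ∈-++⁺ʳ L (here refl)
  ... | no h with ∈-map⁻ proj₁ (dne λ x-new → h (px , x-new))
  ...   | (_ , T) , m , refl = T , m

  backStep-covers : ∀ M n → U (enum𝒳 n) →
    ∃[ p ] (p ∈ pairs (backStep M n) × proj₂ p ≗ₛ enum𝒳 n)
  backStep-covers (L , _) n uT with em {U (enum𝒳 n) × All (λ T′ → ¬ enum𝒳 n ≗ₛ T′) (map proj₂ L)}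
  ... | yes _ = _ , ∈-++⁺ʳ L (here refl) , λ _ → refl
  ... | no h with ¬All¬⇒∃ (map proj₂ L) (λ T-new → h (uT , T-new))
  ...   | _ , m , e with ∈-map⁻ proj₂ m
  ...     | p , m′ , refl = p , m′ , ≗ₛ-sym e

  Occurs : V → Set
  Occurs x = ∃[ n ] ∃[ T ] ((x , T) ∈ pairs (stage n))

  f : V → Subset
  f x with em {Occurs x}
  ... | yes (_ , T , _) = T
  ... | no _            = λ _ → false

  f-occurs : ∀ {x} → Occurs x → ∃[ n ] ((x , f x) ∈ pairs (stage n))
  f-occurs {x} o with em {Occurs x}
  ... | yes (n , _ , m) = n , m
  ... | no ¬o           = ⊥-elim (¬o o)

  P⇒occurs : ∀ {x} → P x → ∃[ n ] ((x , f x) ∈ pairs (stage n))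
  P⇒occurs {x} px with enumℤ-onto x
  ... | n , refl = let T , m = forthStep-covers (stage n) n px in
                   f-occurs (suc n , T , backStep-⊇ (forthStep (stage n) n) n m)

  f-good : ∀ {x} → P x → U (f x) × R x (f x)
  f-good {x} px =
    let n , m = P⇒occurs {x} px ; _ , u , r = All.lookup (proj₁ (proj₂ (stage n))) m in u , r

  f-injective : ∀ {x x′} → P x → P x′ → f x ≗ₛ f x′ → x ≡ x′
  f-injective {x} {x′} px px′ =
    proj₂ (functional {p = x , f x} {x′ , f x′} (P⇒occurs {x} px) (P⇒occurs {x′} px′))

  f-onto : ∀ {T} → U T → ∃[ x ] (P x × f x ≗ₛ T)
  f-onto {T} uT =
    let n , e = enum𝒳-onto (U⇒In𝒳 uT)
        p , m , e′ = backStep-covers (forthStep (stage n) n) n (U-resp {T} (≗ₛ-sym e) uT)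
        px , _ = All.lookup (proj₁ (proj₂ (stage (suc n)))) m
        occ = f-occurs (suc n , proj₂ p , m)
        fp≗p = proj₁ (functional {p = proj₁ p , f (proj₁ p)} {p} occ (suc n , m)) refl
    in proj₁ p , px , ≗ₛ-trans fp≗p (≗ₛ-trans e′ e)

-- Closed extensions

record ClosedExtension (s : Cond) (a : V) : Set where
  field
    t          : Cond
    s⊑t        : s ⊑ t
    closed     : Closed t
    a∈dom      : Dom t a
    inAll      : ℕ → ℕ
    inNone     : ℕ → ℕ
    inAll-inc  : StrictlyIncreasing inAll
    inNone-inc : StrictlyIncreasing inNone
    inAll∉dom  : ∀ n → dom (σ t) (+ inAll n) ≡ false
    inAll∈val  : ∀ n u → Dom t u → Val t u ∋ (+ inAll n)
    inNone∉val : ∀ n u → Dom t u → Val t u -[1+ inNone n ] ≡ false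

  inNone∉dom : ∀ n → dom (σ t) -[1+ inNone n ] ≡ false
  inNone∉dom n = ¬-not λ d → true⇒¬false (self t _ d) (inNone∉val n _ d)

-- The domain of s is enlarged to everything except two infinite reserves: a set of points
-- lying in every value and a set of points lying in no value; the new points are matched by
-- back and forth with all members of 𝒳 that respect the reserves and are not yet values.
module ClosedExtensionConstruction (em : ExcludedMiddle 0ℓ) (s : Cond) (a : V) where

  open Classical em

  InAll : V → Set
  InAll z = (∀ u → Dom s u → Val s u ∋ z) × dom (σ s) z ≡ false

  InNone : V → Set
  InNone z = ∀ u → Dom s u → Val s u z ≡ false

  -- With an element u₀ in the domain, the exceptional list of Val s u₀ confines InAll to
  -- nonnegative and InNone to negative points, up to finitely many.
  InAll-unbounded : Unbounded (λ m → InAll (+ m))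
  InAll-unbounded b with em {∃[ u ] Dom s u}
  ... | no ¬dom = suc b , ℕ.n<1+n b , (λ u d → ⊥-elim (¬dom (u , d))) , ¬-not (λ d → ¬dom (_ , d))
  ... | yes (u₀ , d₀) = beyond (Infinite⇒fresh (infCap s) (map (λ m → + m) (upTo (suc b)) ++ L₀))
    where
    L₀ = proj₁ (into𝒳 s u₀ d₀)
    beyond : ∃[ z ] (InAll z × z ∉ map (λ m → + m) (upTo (suc b)) ++ L₀) →
             ∃[ m ] (b < m × InAll (+ m))
    beyond (+ m , inAll , fresh) = m , ∉upTo⇒> (fresh ∘ ∈-++⁺ˡ ∘ ∈-map⁺ (λ m → + m)) , inAll
    beyond (-[1+ m ] , inAll , fresh) =
      ⊥-elim (fresh (∈-++⁺ʳ _ (proj₂ (into𝒳 s u₀ d₀) _ (cong (_xor false) (proj₁ inAll u₀ d₀)))))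

  InNone-unbounded : Unbounded (λ m → InNone -[1+ m ])
  InNone-unbounded b with em {∃[ u ] Dom s u}
  ... | no ¬dom = suc b , ℕ.n<1+n b , (λ u d → ⊥-elim (¬dom (u , d)))
  ... | yes (u₀ , d₀) = beyond (Infinite⇒fresh (infCup s) (map -[1+_] (upTo (suc b)) ++ L₀))
    where
    L₀ = proj₁ (into𝒳 s u₀ d₀)
    beyond : ∃[ z ] (InNone z × z ∉ map -[1+_] (upTo (suc b)) ++ L₀) →
             ∃[ m ] (b < m × InNone -[1+ m ])
    beyond (-[1+ m ] , inNone , fresh) = m , ∉upTo⇒> (fresh ∘ ∈-++⁺ˡ ∘ ∈-map⁺ -[1+_]) , inNone
    beyond (+ m , inNone , fresh) =
      ⊥-elim (fresh (∈-++⁺ʳ _ (proj₂ (into𝒳 s u₀ d₀) _ (cong (_xor true) (inNone u₀ d₀)))))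

  module InAll⁺  = Enumeration InAll-unbounded ∣ a ∣
  module InNone⁻ = Enumeration InNone-unbounded ∣ a ∣

  -- Even-indexed points of the first enumeration stay reserved; odd-indexed ones are spares
  -- from which back and forth draws fresh points.
  kept spare avoided : ℕ → ℕ
  kept n    = InAll⁺.nth (2 * n)
  spare n   = InAll⁺.nth (suc (2 * n))
  avoided n = InNone⁻.nth n

  kept-inc : StrictlyIncreasing kept
  kept-inc = StrictlyIncreasing-∘ InAll⁺.nth-strictlyIncreasing 2*-strictlyIncreasing

  spare-inc : StrictlyIncreasing spare
  spare-inc = StrictlyIncreasing-∘ InAll⁺.nth-strictlyIncreasing 1+2*-strictlyIncreasing

  kept≢spare : ∀ m n → + kept m ≢ + spare n
  kept≢spare m n = even≢odd-values InAll⁺.nth-strictlyIncreasing m n ∘ ℤ.+-injective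

  Reserved : V → Set
  Reserved z = (∃[ n ] (+ kept n ≡ z)) ⊎ (∃[ n ] (-[1+ avoided n ] ≡ z))

  dom₁ : Subset
  dom₁ z = not ⌊ Reserved z ⌋

  dom₁-true : ∀ {z} → ¬ Reserved z → dom₁ z ≡ true
  dom₁-true = cong not ∘ ⌊⌋-false

  dom₁-false : ∀ {z} → Reserved z → dom₁ z ≡ false
  dom₁-false = cong not ∘ ⌊⌋-true

  dom₁-unreserved : ∀ {z} → dom₁ z ≡ true → ¬ Reserved z
  dom₁-unreserved d r = true⇒¬false d (dom₁-false r)

  spare-unreserved : ∀ n → ¬ Reserved (+ spare n)
  spare-unreserved n (inj₁ (m , e)) = kept≢spare m n e
  spare-unreserved n (inj₂ (m , ()))

  spare∈InAll : ∀ n → InAll (+ spare n)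
  spare∈InAll n = InAll⁺.nth-satisfies (suc (2 * n))

  kept∈InAll : ∀ n → InAll (+ kept n)
  kept∈InAll n = InAll⁺.nth-satisfies (2 * n)

  avoided∈InNone : ∀ n → InNone -[1+ avoided n ]
  avoided∈InNone = InNone⁻.nth-satisfies

  dom-s⊆dom₁ : ∀ {u} → Dom s u → dom₁ u ≡ true
  dom-s⊆dom₁ d = dom₁-true λ
    { (inj₁ (n , refl)) → true⇒¬false d (proj₂ (kept∈InAll n))
    ; (inj₂ (n , refl)) → true⇒¬false (self s _ d) (avoided∈InNone n _ d) }

  a∈dom₁ : dom₁ a ≡ true
  a∈dom₁ = dom₁-true λ
    { (inj₁ (n , e)) → ℕ.<-irrefl (cong ∣_∣ (sym e)) (InAll⁺.bound<nth (2 * n))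
    ; (inj₂ (n , e)) → ℕ.<-irrefl (cong ∣_∣ (sym e)) (ℕ.<-trans (InNone⁻.bound<nth n) (ℕ.n<1+n _)) }

  Admissible : Subset → Set
  Admissible T = In𝒳 T × (∀ n → T ∋ (+ kept n)) × (∀ n → T -[1+ avoided n ] ≡ false)

  Admissible-resp : ∀ {T T′} → T ≗ₛ T′ → Admissible T → Admissible T′
  Admissible-resp e (c , keeps , avoids) =
    In𝒳-resp e c ,
    (λ n → trans (sym (e _)) (keeps n)) , (λ n → trans (sym (e _)) (avoids n))

  old-Admissible : ∀ {u} → Dom s u → Admissible (Val s u)
  old-Admissible d = into𝒳 s _ d , (λ n → proj₁ (kept∈InAll n) _ d) , (λ n → avoided∈InNone n _ d)

  New : V → Set
  New x = dom₁ x ≡ true × dom (σ s) x ≡ false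

  Unused : Subset → Set
  Unused T = Admissible T × (∀ u → Dom s u → ¬ Val s u ≗ₛ T)

  Unused-resp : ∀ {T T′} → T ≗ₛ T′ → Unused T → Unused T′
  Unused-resp e (adm , unused) =
    Admissible-resp e adm , λ u d e′ → unused u d (≗ₛ-trans e′ (≗ₛ-sym e))

  -- ω with x added and a spare point y removed: y lies in every old value and in every
  -- member of 𝒳 whose exceptions avoid it.
  forth : ∀ x → New x → (Ts : List Subset) → All Unused Ts →
          ∃[ T ] (Unused T × T ∋ x × All (λ T′ → ¬ T ≗ₛ T′) Ts)
  forth x (x∈dom₁ , _) Ts unused =
    T , ((modify-In𝒳 {ω} [ y ] [ x ] ω-In𝒳 , keeps , avoids) , not-old) ,
    modify-adds {ω} {[ y ]} {[ x ]} (here refl) ,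
    All.map (λ T′y e → true⇒¬false T′y (trans (sym (e y)) y∉T)) (exceptions-agree-ω cs (y-fresh ∘ there))
    where
    cs = All.map (proj₁ ∘ proj₁) unused
    E = x ∷ exceptions cs
    y = + spare (suc (size E))
    T = modify ω [ y ] [ x ]
    y-fresh : y ∉ E
    y-fresh = +-beyond∉ spare-inc E
    y∉T : T y ≡ false
    y∉T = modify-removes {ω} {[ y ]} {[ x ]} (here refl) λ { (here y≡x) → y-fresh (here y≡x) }
    keeps : ∀ n → T ∋ (+ kept n)
    keeps n = IsMod-keeps {z = + kept n} (IsMod-modify ω [ y ] [ x ]) refl
                λ { (here e) → kept≢spare n (suc (size E)) e }
    avoids : ∀ n → T -[1+ avoided n ] ≡ false
    avoids n = IsMod-avoids {z = -[1+ avoided n ]} (IsMod-modify ω [ y ] [ x ]) refl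
                 λ { (here e) → dom₁-unreserved x∈dom₁ (inj₂ (n , e)) }
    not-old : ∀ u → Dom s u → ¬ Val s u ≗ₛ T
    not-old u d e = true⇒¬false (trans (sym (e y)) (proj₁ (spare∈InAll (suc (size E))) u d)) y∉T

  back : ∀ T → Unused T → (xs : List V) → ∃[ x ] (New x × T ∋ x × x ∉ xs)
  back T (((L , covers) , _) , _) xs =
    x , (dom₁-true (spare-unreserved n) , proj₂ (spare∈InAll n)) ,
    In𝒳-agrees-ω {T} (L , covers) (x-fresh ∘ ∈-++⁺ʳ xs) , x-fresh ∘ ∈-++⁺ˡ
    where
    n = suc (size (xs ++ L))
    x = + spare n
    x-fresh : x ∉ xs ++ L
    x-fresh = +-beyond∉ spare-inc (xs ++ L)

  module Matching = BackAndForth em New Unused (λ x T → T ∋ x) (proj₁ ∘ proj₁) Unused-resp forth back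
  open Matching using (f; f-good; f-injective; f-onto)

  val₁ : V → Subset
  val₁ z = if dom (σ s) z then Val s z else f z

  val₁-old : ∀ {z} → Dom s z → val₁ z ≗ₛ Val s z
  val₁-old d _ rewrite d = refl

  val₁-new : ∀ {z} → dom (σ s) z ≡ false → val₁ z ≗ₛ f z
  val₁-new d _ rewrite d = refl

  val₁-Admissible : ∀ {u} → dom₁ u ≡ true → Admissible (val₁ u)
  val₁-Admissible {u} d₁ with dom-cases s u
  ... | inj₁ d = Admissible-resp (≗ₛ-sym (val₁-old d)) (old-Admissible d)
  ... | inj₂ d = Admissible-resp (≗ₛ-sym (val₁-new d)) (proj₁ (proj₁ (f-good {u} (d₁ , d))))

  val₁-injective : ∀ u v → dom₁ u ≡ true → dom₁ v ≡ true → val₁ u ≗ₛ val₁ v → u ≡ v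
  val₁-injective u v du dv e with dom-cases s u | dom-cases s v
  ... | inj₁ ou | inj₁ ov = inj s u v ou ov
                              (≗ₛ-trans (≗ₛ-sym (val₁-old ou)) (≗ₛ-trans e (val₁-old ov)))
  ... | inj₂ nu | inj₂ nv = f-injective (du , nu) (dv , nv)
                              (≗ₛ-trans (≗ₛ-sym (val₁-new nu)) (≗ₛ-trans e (val₁-new nv)))
  ... | inj₁ ou | inj₂ nv = ⊥-elim (proj₂ (proj₁ (f-good {v} (dv , nv))) u ou
                              (≗ₛ-trans (≗ₛ-sym (val₁-old ou)) (≗ₛ-trans e (val₁-new nv))))
  ... | inj₂ nu | inj₁ ov = ⊥-elim (proj₂ (proj₁ (f-good {u} (du , nu))) v ov
                              (≗ₛ-trans (≗ₛ-sym (val₁-old ov)) (≗ₛ-trans (≗ₛ-sym e) (val₁-new nu))))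

  val₁-self : ∀ u → dom₁ u ≡ true → val₁ u ∋ u
  val₁-self u d₁ with dom-cases s u
  ... | inj₁ d = trans (val₁-old d u) (self s u d)
  ... | inj₂ d = trans (val₁-new d u) (proj₂ (f-good {u} (d₁ , d)))

  kept∈val₁ : ∀ n u → dom₁ u ≡ true → val₁ u ∋ (+ kept n)
  kept∈val₁ n u d = proj₁ (proj₂ (val₁-Admissible d)) n

  avoided∉val₁ : ∀ n u → dom₁ u ≡ true → val₁ u -[1+ avoided n ] ≡ false
  avoided∉val₁ n u d = proj₂ (proj₂ (val₁-Admissible d)) n

  t₁ : Cond
  t₁ = record
    { σ      = record { dom = dom₁ ; val = val₁ }
    ; into𝒳  = λ u d → proj₁ (val₁-Admissible d)
    ; inj    = val₁-injective
    ; self   = val₁-self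
    ; infCap = +-image-Infinite kept-inc λ n → (λ u → kept∈val₁ n u) , dom₁-false (inj₁ (n , refl))
    ; infCup = -[1+]-image-Infinite InNone⁻.nth-strictlyIncreasing avoided∉val₁
    }

  s⊑t₁ : s ⊑ t₁
  s⊑t₁ u d = dom-s⊆dom₁ d , ≗ₛ-sym (val₁-old d)

  reserved∉ : ∀ {A z} → All (Dom t₁) A → Reserved z → z ∉ A
  reserved∉ dA r z∈A = dom₁-unreserved (All.lookup dA z∈A) r

  -- A modification of a value by domain points respects the reserves, so it is either an
  -- old value or matched with a new point.
  t₁-closed : Closed t₁
  t₁-closed = diff-closed , mod-closed
    where
    diff-closed : ∀ {u v x} → Dom t₁ u → Dom t₁ v → Val t₁ u ∋ x → Val t₁ v x ≡ false → Dom t₁ x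
    diff-closed du dv x∈u x∉v = dom₁-true λ
      { (inj₁ (n , refl)) → true⇒¬false (kept∈val₁ n _ dv) x∉v
      ; (inj₂ (n , refl)) → true⇒¬false x∈u (avoided∉val₁ n _ du) }
    mod-closed : ∀ u A B → Dom t₁ u → All (Dom t₁) A → All (Dom t₁) B →
                 ∃[ v ] (Dom t₁ v × IsMod (Val t₁ v) (Val t₁ u) A B)
    mod-closed u A B du dA dB with em {∃[ w ] (Dom s w × Val s w ≗ₛ modify (val₁ u) A B)}
    ... | yes (w , dw , e) =
          w , dom-s⊆dom₁ dw , IsMod-resp (≗ₛ-trans (≗ₛ-sym e) (≗ₛ-sym (val₁-old dw))) (λ _ → refl) M
      where M = IsMod-modify (val₁ u) A B
    ... | no ¬old =
          let x , (x∈dom₁ , x∉s) , fx≗T = f-onto (T-Admissible , λ w dw e → ¬old (w , dw , e))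
          in x , x∈dom₁ , IsMod-resp (≗ₛ-trans (≗ₛ-sym fx≗T) (≗ₛ-sym (val₁-new x∉s))) (λ _ → refl) M
      where
      M = IsMod-modify (val₁ u) A B
      T-Admissible : Admissible (modify (val₁ u) A B)
      T-Admissible =
        modify-In𝒳 {val₁ u} A B (proj₁ (val₁-Admissible du)) ,
        (λ n → IsMod-keeps {z = + kept n} M (kept∈val₁ n u du) (reserved∉ dA (inj₁ (n , refl)))) ,
        (λ n → IsMod-avoids {z = -[1+ avoided n ]} M (avoided∉val₁ n u du)
                 (reserved∉ dB (inj₂ (n , refl))))

  closedExtension : ClosedExtension s a
  closedExtension = record
    { t          = t₁
    ; s⊑t        = s⊑t₁
    ; closed     = t₁-closed
    ; a∈dom      = a∈dom₁
    ; inAll      = kept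
    ; inNone     = avoided
    ; inAll-inc  = kept-inc
    ; inNone-inc = InNone⁻.nth-strictlyIncreasing
    ; inAll∉dom  = λ n → dom₁-false (inj₁ (n , refl))
    ; inAll∈val  = kept∈val₁
    ; inNone∉val = avoided∉val₁
    }

-- Copying onto reserve points

module CopyExtension (em : ExcludedMiddle 0ℓ) (x₀ y₀ : V) (ps′ : List (V × V)) (a : V)
  (t₀ : Cond) (good : Good₂ t₀ ((x₀ , y₀) ∷ ps′)) where

  open Classical em

  ps : List (V × V)
  ps = (x₀ , y₀) ∷ ps′

  xs ys : List V
  xs = map proj₁ ps
  ys = map proj₂ ps

  good-xs : Good₁ t₀ xs
  good-xs = proj₁ good

  good-ys : Good₁ t₀ ys
  good-ys = proj₁ (proj₂ good)

  f₀ g₀ : V → V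
  f₀ = proj₁ (proj₂ (proj₂ good))
  g₀ = proj₁ (proj₂ (proj₂ (proj₂ good)))

  D D′ : V → Set
  D  = Δ t₀ xs
  D′ = Δ t₀ ys

  iso : IsIso t₀ xs ys f₀ g₀
  iso = proj₁ (proj₂ (proj₂ (proj₂ (proj₂ good))))

  f₀-maps : All (λ p → f₀ (proj₁ p) ≡ proj₂ p) ps
  f₀-maps = proj₂ (proj₂ (proj₂ (proj₂ (proj₂ good))))

  f₀-into : ∀ {e} → D e → D′ (f₀ e)
  f₀-into = proj₁ iso _

  g₀-into : ∀ {e} → D′ e → D (g₀ e)
  g₀-into = proj₁ (proj₂ iso) _

  g₀∘f₀ : ∀ {e} → D e → g₀ (f₀ e) ≡ e
  g₀∘f₀ = proj₁ (proj₂ (proj₂ iso)) _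

  f₀∘g₀ : ∀ {e} → D′ e → f₀ (g₀ e) ≡ e
  f₀∘g₀ = proj₁ (proj₂ (proj₂ (proj₂ iso))) _

  open ClosedExtension (ClosedExtensionConstruction.closedExtension em t₀ a)
    renaming (t to t₁; s⊑t to t₀⊑t₁)

  E : V → Set
  E = Δ t₁ (xs ++ [ a ])

  S S′ : Subset
  S  = Val t₁ x₀
  S′ = Val t₁ y₀

  D⇒dom₀ : ∀ {e} → D e → Dom t₀ e
  D⇒dom₀ = proj₁ good-xs _

  D′⇒dom₀ : ∀ {e} → D′ e → Dom t₀ e
  D′⇒dom₀ = proj₁ good-ys _

  dom₀⇒dom₁ : ∀ {e} → Dom t₀ e → Dom t₁ e
  dom₀⇒dom₁ d = proj₁ (t₀⊑t₁ _ d)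

  val₁≗val₀ : ∀ {e} → Dom t₀ e → Val t₁ e ≗ₛ Val t₀ e
  val₁≗val₀ d = ≗ₛ-sym (proj₂ (t₀⊑t₁ _ d))

  x₀∈D : D x₀
  x₀∈D = base (here refl)

  y₀∈D′ : D′ y₀
  y₀∈D′ = base (here refl)

  f₀x₀≡y₀ : f₀ x₀ ≡ y₀
  f₀x₀≡y₀ = All.head f₀-maps

  good-E : Good₁ t₁ (xs ++ [ a ])
  good-E = Closed⇒Good₁ closed λ z∈ → case (∈-++⁻ xs z∈)
    where
    case : ∀ {z} → z ∈ xs ⊎ z ∈ [ a ] → Dom t₁ z
    case (inj₁ z∈xs)        = dom₀⇒dom₁ (D⇒dom₀ (base z∈xs))
    case (inj₂ (here refl)) = a∈dom

  E⇒dom₁ : ∀ {e} → E e → Dom t₁ e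
  E⇒dom₁ = proj₁ good-E _

  D⇒E : ∀ {e} → D e → E e
  D⇒E = Δ-mono ∈-++⁺ˡ ∘ Δ-⊑ t₀⊑t₁

  a∈E : E a
  a∈E = base (∈-++⁺ʳ xs (here refl))

  x₀∈E : E x₀
  x₀∈E = D⇒E x₀∈D

  val₁-f₀ : ∀ {u x} → D u → D x → Val t₁ (f₀ u) (f₀ x) ≡ Val t₁ u x
  val₁-f₀ {u} {x} du dx = begin
    Val t₁ (f₀ u) (f₀ x) ≡⟨ val₁≗val₀ (D′⇒dom₀ (f₀-into du)) (f₀ x) ⟩
    Val t₀ (f₀ u) (f₀ x) ≡⟨ Bool-ext (λ e → proj₂ (from (∈-iso x u dx du) (D′⇒dom₀ (f₀-into du) , e)))
                                     (λ e → proj₂ (to (∈-iso x u dx du) (D⇒dom₀ du , e))) ⟩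
    Val t₀ u x           ≡⟨ ≗ₛ-sym (val₁≗val₀ (D⇒dom₀ du)) x ⟩
    Val t₁ u x           ∎
    where
    open ≡-Reasoning
    ∈-iso = proj₂ (proj₂ (proj₂ (proj₂ iso)))

  -- Even-indexed reserve points serve as copies of the points outside D.
  copyPoint : Bool → V → V
  copyPoint true  e = + inAll (2 * encodeℤ e)
  copyPoint false e = -[1+ inNone (2 * encodeℤ e) ]

  copyPoint∉dom₁ : ∀ b e → dom (σ t₁) (copyPoint b e) ≡ false
  copyPoint∉dom₁ true  e = inAll∉dom (2 * encodeℤ e)
  copyPoint∉dom₁ false e = inNone∉dom (2 * encodeℤ e)

  val₁-copyPoint : ∀ b e {u} → Dom t₁ u → Val t₁ u (copyPoint b e) ≡ b
  val₁-copyPoint true  e d = inAll∈val (2 * encodeℤ e) _ d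
  val₁-copyPoint false e d = inNone∉val (2 * encodeℤ e) _ d

  copyPoint-injective : ∀ {b b′ e e′} → copyPoint b e ≡ copyPoint b′ e′ → e ≡ e′
  copyPoint-injective {true}  {true}  eq =
    encodeℤ-injective (ℕ.*-cancelˡ-≡ _ _ 2 (strictlyIncreasing-injective inAll-inc (ℤ.+-injective eq)))
  copyPoint-injective {false} {false} eq =
    encodeℤ-injective (ℕ.*-cancelˡ-≡ _ _ 2 (strictlyIncreasing-injective inNone-inc (ℤ.-[1+-injective eq)))
  copyPoint-injective {true}  {false} ()
  copyPoint-injective {false} {true}  ()

  -- The odd-indexed reserve points stay reserved in the extension.
  copyPoint≢+odd : ∀ b e k → copyPoint b e ≢ + inAll (suc (2 * k))
  copyPoint≢+odd true  e k = even≢odd-values inAll-inc (encodeℤ e) k ∘ ℤ.+-injective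
  copyPoint≢+odd false e k ()

  copyPoint≢-odd : ∀ b e k → copyPoint b e ≢ -[1+ inNone (suc (2 * k)) ]
  copyPoint≢-odd true  e k ()
  copyPoint≢-odd false e k = even≢odd-values inNone-inc (encodeℤ e) k ∘ ℤ.-[1+-injective

  copy : V → V
  copy e = copyPoint (S e) e

  g : V → V
  g e = if ⌊ D e ⌋ then f₀ e else copy e

  g-D : ∀ {e} → D e → g e ≡ f₀ e
  g-D {e} d = cong (if_then f₀ e else copy e) (⌊⌋-true d)

  g-¬D : ∀ {e} → ¬ D e → g e ≡ copy e
  g-¬D {e} ¬d = cong (if_then f₀ e else copy e) (⌊⌋-false ¬d)

  f₀-dom₁ : ∀ {e} → D e → Dom t₁ (f₀ e)
  f₀-dom₁ = dom₀⇒dom₁ ∘ D′⇒dom₀ ∘ f₀-into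

  g-D-dom₁ : ∀ {e} → D e → Dom t₁ (g e)
  g-D-dom₁ d = subst (Dom t₁) (sym (g-D d)) (f₀-dom₁ d)

  g-¬D-dom₁ : ∀ {e} → ¬ D e → dom (σ t₁) (g e) ≡ false
  g-¬D-dom₁ {e} ¬d = subst (λ z → dom (σ t₁) z ≡ false) (sym (g-¬D ¬d)) (copyPoint∉dom₁ (S e) e)

  g-D≢g-¬D : ∀ {e e′} → D e → ¬ D e′ → g e ≢ g e′
  g-D≢g-¬D d ¬d′ eq =
    true⇒¬false (g-D-dom₁ d) (subst (λ z → dom (σ t₁) z ≡ false) (sym eq) (g-¬D-dom₁ ¬d′))

  g-injective : ∀ {e e′} → E e → E e′ → g e ≡ g e′ → e ≡ e′
  g-injective {e} {e′} _ _ eq with decide (D e) | decide (D e′)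
  ... | inj₁ d | inj₁ d′ = begin
        e            ≡⟨ sym (g₀∘f₀ d) ⟩
        g₀ (f₀ e)    ≡⟨ cong g₀ (trans (sym (g-D d)) (trans eq (g-D d′))) ⟩
        g₀ (f₀ e′)   ≡⟨ g₀∘f₀ d′ ⟩
        e′           ∎
    where open ≡-Reasoning
  ... | inj₂ ¬d | inj₂ ¬d′ = copyPoint-injective (trans (sym (g-¬D ¬d)) (trans eq (g-¬D ¬d′)))
  ... | inj₁ d  | inj₂ ¬d′ = ⊥-elim (g-D≢g-¬D d ¬d′ eq)
  ... | inj₂ ¬d | inj₁ d′  = ⊥-elim (g-D≢g-¬D d′ ¬d (sym eq))

  InImage : V → Set
  InImage z = ∃[ e ] (E e × g e ≡ z)

  g⁻¹ : V → V
  g⁻¹ z with em {InImage z}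
  ... | yes (e , _) = e
  ... | no _        = z

  g⁻¹-image : ∀ {z} → InImage z → E (g⁻¹ z) × g (g⁻¹ z) ≡ z
  g⁻¹-image {z} i with em {InImage z}
  ... | yes (_ , e∈ , eq) = e∈ , eq
  ... | no ¬i             = ⊥-elim (¬i i)

  g⁻¹∘g : ∀ {e} → E e → g⁻¹ (g e) ≡ e
  g⁻¹∘g {e} e∈ = let e′∈ , eq = g⁻¹-image (e , e∈ , refl) in g-injective e′∈ e∈ eq

  D′⇒InImage : ∀ {z} → D′ z → InImage z
  D′⇒InImage {z} d = g₀ z , D⇒E (g₀-into d) , trans (g-D (g₀-into d)) (f₀∘g₀ d)

  copyValue : V → Subset
  copyValue e w = if ⌊ InImage w ⌋ then Val t₁ e (g⁻¹ w) else S′ w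

  copyValue-image : ∀ e {w} → InImage w → copyValue e w ≡ Val t₁ e (g⁻¹ w)
  copyValue-image e {w} i = cong (if_then Val t₁ e (g⁻¹ w) else S′ w) (⌊⌋-true i)

  copyValue-outside : ∀ e {w} → ¬ InImage w → copyValue e w ≡ S′ w
  copyValue-outside e {w} ¬i = cong (if_then Val t₁ e (g⁻¹ w) else S′ w) (⌊⌋-false ¬i)

  dom₂ : Subset
  dom₂ z = dom (σ t₁) z ∨ ⌊ InImage z ⌋

  val₂ : V → Subset
  val₂ z = if dom (σ t₁) z then Val t₁ z else copyValue (g⁻¹ z)

  val₂-old : ∀ {z} → Dom t₁ z → val₂ z ≗ₛ Val t₁ z
  val₂-old d _ rewrite d = refl

  val₂-new : ∀ {z} → dom (σ t₁) z ≡ false → val₂ z ≗ₛ copyValue (g⁻¹ z)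
  val₂-new d _ rewrite d = refl

  val₂-copy : ∀ {e} → E e → ¬ D e → val₂ (g e) ≗ₛ copyValue e
  val₂-copy {e} e∈ ¬d w = trans (val₂-new (g-¬D-dom₁ ¬d) w) (cong (λ c → copyValue c w) (g⁻¹∘g e∈))

  dom₂-old : ∀ {z} → Dom t₁ z → dom₂ z ≡ true
  dom₂-old d rewrite d = refl

  dom₂-image : ∀ {z} → InImage z → dom₂ z ≡ true
  dom₂-image {z} i rewrite ⌊⌋-true i = ∨-zeroʳ (dom (σ t₁) z)

  dom₂-cases : ∀ {z} → dom₂ z ≡ true → Dom t₁ z ⊎ ∃[ e ] (E e × ¬ D e × g e ≡ z)
  dom₂-cases {z} d₂ with dom-cases t₁ z | decide (InImage z)
  ... | inj₁ d | _       = inj₁ d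
  ... | inj₂ d | inj₂ ¬i = ⊥-elim (true⇒¬false d₂ (outside d ¬i))
    where
    outside : dom (σ t₁) z ≡ false → ¬ InImage z → dom₂ z ≡ false
    outside d ¬i rewrite d | ⌊⌋-false ¬i = refl
  ... | inj₂ d | inj₁ (e , e∈ , refl) with decide (D e)
  ...   | inj₁ de  = ⊥-elim (true⇒¬false (g-D-dom₁ de) d)
  ...   | inj₂ ¬de = inj₂ (e , e∈ , ¬de , refl)

  D-outside-S : ∀ {u x} → D u → ¬ D x → Val t₁ u x ≡ S x
  D-outside-S {u} {x} du ¬dx = begin
    Val t₁ u x   ≡⟨ val₁≗val₀ (D⇒dom₀ du) x ⟩
    Val t₀ u x   ≡⟨ Δ-values-agree (D⇒dom₀ du) (D⇒dom₀ x₀∈D) du x₀∈D ¬dx ⟩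
    Val t₀ x₀ x  ≡⟨ ≗ₛ-sym (val₁≗val₀ (D⇒dom₀ x₀∈D)) x ⟩
    S x          ∎
    where open ≡-Reasoning

  val₂-outside-image : ∀ {u w} → E u → ¬ InImage w → val₂ (g u) w ≡ S′ w
  val₂-outside-image {u} {w} u∈ ¬i with decide (D u)
  ... | inj₂ ¬du = trans (val₂-copy u∈ ¬du w) (copyValue-outside u ¬i)
  ... | inj₁ du = begin
    val₂ (g u) w      ≡⟨ cong (λ c → val₂ c w) (g-D du) ⟩
    val₂ (f₀ u) w     ≡⟨ val₂-old (dom₀⇒dom₁ fu∈) w ⟩
    Val t₁ (f₀ u) w   ≡⟨ val₁≗val₀ fu∈ w ⟩
    Val t₀ (f₀ u) w   ≡⟨ Δ-values-agree fu∈ (D′⇒dom₀ y₀∈D′) (f₀-into du) y₀∈D′ (¬i ∘ D′⇒InImage) ⟩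
    Val t₀ y₀ w       ≡⟨ ≗ₛ-sym (val₁≗val₀ (D′⇒dom₀ y₀∈D′)) w ⟩
    S′ w              ∎
    where
    open ≡-Reasoning
    fu∈ = D′⇒dom₀ (f₀-into du)

  val₂-image : ∀ {u x} → E u → E x → val₂ (g u) (g x) ≡ Val t₁ u x
  val₂-image {u} {x} u∈ x∈ with decide (D u) | decide (D x)
  ... | inj₂ ¬du | _ = begin
    val₂ (g u) (g x)         ≡⟨ val₂-copy u∈ ¬du (g x) ⟩
    copyValue u (g x)        ≡⟨ copyValue-image u (x , x∈ , refl) ⟩
    Val t₁ u (g⁻¹ (g x))     ≡⟨ cong (Val t₁ u) (g⁻¹∘g x∈) ⟩
    Val t₁ u x               ∎
    where open ≡-Reasoning
  ... | inj₁ du | inj₁ dx = begin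
    val₂ (g u) (g x)         ≡⟨ cong₂ val₂ (g-D du) (g-D dx) ⟩
    val₂ (f₀ u) (f₀ x)       ≡⟨ val₂-old (f₀-dom₁ du) (f₀ x) ⟩
    Val t₁ (f₀ u) (f₀ x)     ≡⟨ val₁-f₀ du dx ⟩
    Val t₁ u x               ∎
    where open ≡-Reasoning
  ... | inj₁ du | inj₂ ¬dx = begin
    val₂ (g u) (g x)         ≡⟨ cong₂ val₂ (g-D du) (g-¬D ¬dx) ⟩
    val₂ (f₀ u) (copy x)     ≡⟨ val₂-old (f₀-dom₁ du) (copy x) ⟩
    Val t₁ (f₀ u) (copy x)   ≡⟨ val₁-copyPoint (S x) x (f₀-dom₁ du) ⟩
    S x                      ≡⟨ sym (D-outside-S du ¬dx) ⟩
    Val t₁ u x               ∎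
    where open ≡-Reasoning

  S′∘g : ∀ {e} → E e → S′ (g e) ≡ S e
  S′∘g {e} e∈ = begin
    S′ (g e)         ≡⟨ sym (val₂-old (dom₀⇒dom₁ (D′⇒dom₀ y₀∈D′)) (g e)) ⟩
    val₂ y₀ (g e)    ≡⟨ cong (λ c → val₂ c (g e)) (sym (trans (g-D x₀∈D) f₀x₀≡y₀)) ⟩
    val₂ (g x₀) (g e) ≡⟨ val₂-image x₀∈E e∈ ⟩
    S e              ∎
    where open ≡-Reasoning

  E-In𝒳 : ∀ {e} → E e → In𝒳 (Val t₁ e)
  E-In𝒳 e∈ = into𝒳 t₁ _ (E⇒dom₁ e∈)

  -- Off the image copyValue e is S′; on it, it differs from S′ only at g-images of the
  -- points where Val t₁ e differs from S.
  copyValue-In𝒳 : ∀ {e} → E e → In𝒳 (copyValue e)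
  copyValue-In𝒳 {e} e∈ = map g (proj₁ (E-In𝒳 e∈) ++ proj₁ (E-In𝒳 x₀∈E)) ++ proj₁ S′-In𝒳 , covers
    where
    S′-In𝒳 : In𝒳 S′
    S′-In𝒳 = into𝒳 t₁ y₀ (dom₀⇒dom₁ (D′⇒dom₀ y₀∈D′))
    asS′ : ∀ {w} → copyValue e w ≡ S′ w → (copyValue e w xor ω w) ≡ true →
           w ∈ map g (proj₁ (E-In𝒳 e∈) ++ proj₁ (E-In𝒳 x₀∈E)) ++ proj₁ S′-In𝒳
    asS′ {w} eq d = ∈-++⁺ʳ _ (proj₂ S′-In𝒳 w (subst (λ b → (b xor ω w) ≡ true) eq d))
    covers : ∀ w → (copyValue e w xor ω w) ≡ true →
             w ∈ map g (proj₁ (E-In𝒳 e∈) ++ proj₁ (E-In𝒳 x₀∈E)) ++ proj₁ S′-In𝒳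
    covers w d with decide (InImage w)
    ... | inj₂ ¬i = asS′ (copyValue-outside e ¬i) d
    ... | inj₁ i with g⁻¹-image i | decide (Val t₁ e (g⁻¹ w) ≡ S (g⁻¹ w))
    ...   | v∈ , gv≡w | inj₁ same =
            asS′ (trans (copyValue-image e i) (trans same (trans (sym (S′∘g v∈)) (cong S′ gv≡w)))) d
    ...   | v∈ , gv≡w | inj₂ differ =
            ∈-++⁺ˡ (subst (_∈ _) gv≡w
              (∈-map⁺ g (In𝒳-differences {Val t₁ e} {S} (E-In𝒳 e∈) (E-In𝒳 x₀∈E) differ)))

  -- If an old value equalled a copied one, Val t₁ e would be a modification of S by points
  -- of D; such a modification is realised inside D, so e ∈ D by injectivity.
  old≢copied : ∀ {z e} → Dom t₁ z → E e → ¬ D e → ¬ val₂ z ≗ₛ val₂ (g e)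
  old≢copied {z} {e} z∈ e∈ ¬de same =
    let A , B , A-diff , B-diff , e-mod = differences-IsMod (Val t₁ e) S _ (λ _ → differ-listed)
        w₀ , w₀∈D , w₀-mod = proj₂ good-xs x₀ A B x₀∈D (All.map differences-in-D A-diff)
                                                        (All.map differences-in-D B-diff)
        w₀-mod₁ = IsMod-resp (≗ₛ-sym (val₁≗val₀ (D⇒dom₀ w₀∈D))) (≗ₛ-sym (val₁≗val₀ (D⇒dom₀ x₀∈D))) w₀-mod
        w₀≡e = inj t₁ w₀ e (dom₀⇒dom₁ (D⇒dom₀ w₀∈D)) (E⇒dom₁ e∈) (IsMod-unique w₀-mod₁ e-mod)
    in ¬de (subst D w₀≡e w₀∈D)
    where
    differ-listed : ∀ {w} → Val t₁ e w ≢ S w → w ∈ proj₁ (E-In𝒳 e∈) ++ proj₁ (E-In𝒳 x₀∈E)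
    differ-listed = In𝒳-differences {Val t₁ e} {S} (E-In𝒳 e∈) (E-In𝒳 x₀∈E)
    differences-in-D : ∀ {w} → Val t₁ e w ≢ S w → D w
    differences-in-D {w} ne with decide (D w) | decide (E w)
    ... | inj₁ dw  | _       = dw
    ... | inj₂ ¬dw | inj₁ w∈ = ⊥-elim (ne (begin
          Val t₁ e w        ≡⟨ sym (val₂-image e∈ w∈) ⟩
          val₂ (g e) (g w)  ≡⟨ sym (same (g w)) ⟩
          val₂ z (g w)      ≡⟨ val₂-old z∈ (g w) ⟩
          Val t₁ z (g w)    ≡⟨ cong (Val t₁ z) (g-¬D ¬dw) ⟩
          Val t₁ z (copy w) ≡⟨ val₁-copyPoint (S w) w z∈ ⟩
          S w               ∎))
      where open ≡-Reasoning
    ... | inj₂ _   | inj₂ ¬w∈ = ⊥-elim (ne (Δ-values-agree (E⇒dom₁ e∈) (E⇒dom₁ x₀∈E) e∈ x₀∈E ¬w∈))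

  val₂-injective : ∀ u v → dom₂ u ≡ true → dom₂ v ≡ true → val₂ u ≗ₛ val₂ v → u ≡ v
  val₂-injective u v du dv same with dom₂-cases du | dom₂-cases dv
  ... | inj₁ u∈ | inj₁ v∈ =
        inj t₁ u v u∈ v∈ (≗ₛ-trans (≗ₛ-sym (val₂-old u∈)) (≗ₛ-trans same (val₂-old v∈)))
  ... | inj₁ u∈ | inj₂ (e , e∈ , ¬de , refl) = ⊥-elim (old≢copied u∈ e∈ ¬de same)
  ... | inj₂ (e , e∈ , ¬de , refl) | inj₁ v∈ = ⊥-elim (old≢copied v∈ e∈ ¬de (≗ₛ-sym same))
  ... | inj₂ (e , e∈ , _ , refl) | inj₂ (e′ , e′∈ , _ , refl) =
        cong g (inj t₁ e e′ (E⇒dom₁ e∈) (E⇒dom₁ e′∈) agree)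
    where
    agree : Val t₁ e ≗ₛ Val t₁ e′
    agree w with decide (E w)
    ... | inj₁ w∈  = trans (sym (val₂-image e∈ w∈)) (trans (same (g w)) (val₂-image e′∈ w∈))
    ... | inj₂ ¬w∈ = trans (Δ-values-agree (E⇒dom₁ e∈) (E⇒dom₁ x₀∈E) e∈ x₀∈E ¬w∈)
                           (sym (Δ-values-agree (E⇒dom₁ e′∈) (E⇒dom₁ x₀∈E) e′∈ x₀∈E ¬w∈))

  val₂-In𝒳 : ∀ z → dom₂ z ≡ true → In𝒳 (val₂ z)
  val₂-In𝒳 z d with dom₂-cases d
  ... | inj₁ z∈ = In𝒳-resp (≗ₛ-sym (val₂-old z∈)) (into𝒳 t₁ z z∈)
  ... | inj₂ (e , e∈ , ¬de , refl) = In𝒳-resp (≗ₛ-sym (val₂-copy e∈ ¬de)) (copyValue-In𝒳 e∈)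

  val₂-self : ∀ z → dom₂ z ≡ true → val₂ z ∋ z
  val₂-self z d with dom₂-cases d
  ... | inj₁ z∈ = trans (val₂-old z∈ z) (self t₁ z z∈)
  ... | inj₂ (e , e∈ , _ , refl) = trans (val₂-image e∈ e∈) (self t₁ e (E⇒dom₁ e∈))

  oddAll oddNone : ℕ → ℕ
  oddAll k  = inAll (suc (2 * k))
  oddNone k = inNone (suc (2 * k))

  oddAll∉image : ∀ k → ¬ InImage (+ oddAll k)
  oddAll∉image k (e , e∈ , ge≡) with decide (D e)
  ... | inj₁ de  = true⇒¬false (subst (Dom t₁) ge≡ (g-D-dom₁ de)) (inAll∉dom (suc (2 * k)))
  ... | inj₂ ¬de = copyPoint≢+odd (S e) e k (trans (sym (g-¬D ¬de)) ge≡)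

  oddNone∉image : ∀ k → ¬ InImage -[1+ oddNone k ]
  oddNone∉image k (e , e∈ , ge≡) with decide (D e)
  ... | inj₁ de  = true⇒¬false (subst (Dom t₁) ge≡ (g-D-dom₁ de)) (inNone∉dom (suc (2 * k)))
  ... | inj₂ ¬de = copyPoint≢-odd (S e) e k (trans (sym (g-¬D ¬de)) ge≡)

  y₀∈dom₁ : Dom t₁ y₀
  y₀∈dom₁ = dom₀⇒dom₁ (D′⇒dom₀ y₀∈D′)

  val₂-outside-copies : ∀ {u w} → dom₂ u ≡ true → ¬ InImage w →
                        (∀ {v} → Dom t₁ v → Val t₁ v w ≡ Val t₁ y₀ w) → val₂ u w ≡ S′ w
  val₂-outside-copies {u} {w} d ¬i uniform with dom₂-cases d
  ... | inj₁ u∈ = trans (val₂-old u∈ w) (uniform u∈)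
  ... | inj₂ (e , e∈ , ¬de , refl) = trans (val₂-copy e∈ ¬de w) (copyValue-outside e ¬i)

  oddAll∈val₂ : ∀ k u → dom₂ u ≡ true → val₂ u ∋ (+ oddAll k)
  oddAll∈val₂ k u d = trans (val₂-outside-copies d (oddAll∉image k)
    (λ v∈ → trans (inAll∈val n _ v∈) (sym (inAll∈val n _ y₀∈dom₁)))) (inAll∈val n _ y₀∈dom₁)
    where n = suc (2 * k)

  oddNone∉val₂ : ∀ k u → dom₂ u ≡ true → val₂ u -[1+ oddNone k ] ≡ false
  oddNone∉val₂ k u d = trans (val₂-outside-copies d (oddNone∉image k)
    (λ v∈ → trans (inNone∉val n _ v∈) (sym (inNone∉val n _ y₀∈dom₁)))) (inNone∉val n _ y₀∈dom₁)
    where n = suc (2 * k)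

  oddAll∉dom₂ : ∀ k → dom₂ (+ oddAll k) ≡ false
  oddAll∉dom₂ k rewrite inAll∉dom (suc (2 * k)) = ⌊⌋-false (oddAll∉image k)

  t₂ : Cond
  t₂ = record
    { σ      = record { dom = dom₂ ; val = val₂ }
    ; into𝒳  = val₂-In𝒳
    ; inj    = val₂-injective
    ; self   = val₂-self
    ; infCap = +-image-Infinite (StrictlyIncreasing-∘ inAll-inc 1+2*-strictlyIncreasing)
                 λ k → (λ u → oddAll∈val₂ k u) , oddAll∉dom₂ k
    ; infCup = -[1+]-image-Infinite (StrictlyIncreasing-∘ inNone-inc 1+2*-strictlyIncreasing)
                 oddNone∉val₂
    }

  t₁⊑t₂ : t₁ ⊑ t₂
  t₁⊑t₂ u d = dom₂-old d , ≗ₛ-sym (val₂-old d)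

  Corresponds : List V → List V → Set
  Corresponds A₁ A = ∀ {e} → E e → (e ∈ A₁ → g e ∈ A) × (g e ∈ A → e ∈ A₁)

  -- Off the image all copied values equal S′, so only the image matters, where val₂ ∘ g
  -- mirrors Val t₁.
  IsMod-transport : ∀ {w u A B A₁ B₁} → E w → E u → All InImage A → All InImage B →
    Corresponds A₁ A → Corresponds B₁ B →
    IsMod (Val t₁ w) (Val t₁ u) A₁ B₁ → IsMod (val₂ (g w)) (val₂ (g u)) A B
  IsMod-transport {w} {u} w∈ u∈ A⊆ B⊆ cA cB m z with decide (InImage z)
  ... | inj₁ (e , e∈ , refl) = mk⇔
        (λ h → Sum.map (λ (p , q) → trans (val₂-image u∈ e∈) p , q ∘ proj₂ (cA e∈)) (proj₁ (cB e∈))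
                 (to (m e) (trans (sym (val₂-image w∈ e∈)) h)))
        (λ h → trans (val₂-image w∈ e∈) (from (m e) (Sum.map
                 (λ (p , q) → trans (sym (val₂-image u∈ e∈)) p , q ∘ proj₁ (cA e∈)) (proj₂ (cB e∈)) h)))
  ... | inj₂ ¬i = mk⇔
        (λ h → inj₁ (trans (val₂-outside-image u∈ ¬i) (trans (sym (val₂-outside-image w∈ ¬i)) h) ,
                     ¬i ∘ All.lookup A⊆))
        (λ { (inj₁ (p , _)) → trans (val₂-outside-image w∈ ¬i) (trans (sym (val₂-outside-image u∈ ¬i)) p)
           ; (inj₂ z∈B)     → ⊥-elim (¬i (All.lookup B⊆ z∈B)) })

  g⁻¹-Corresponds : ∀ {A} → All InImage A → Corresponds (map g⁻¹ A) A
  g⁻¹-Corresponds {A} A⊆ {e} e∈ =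
    (λ m → let z , z∈A , e≡ = ∈-map⁻ g⁻¹ m in
           subst (_∈ A) (trans (sym (proj₂ (g⁻¹-image (All.lookup A⊆ z∈A)))) (cong g (sym e≡))) z∈A) ,
    (λ m → subst (_∈ map g⁻¹ A) (g⁻¹∘g e∈) (∈-map⁺ g⁻¹ m))

  g-Corresponds : ∀ {A} → All E A → Corresponds A (map g A)
  g-Corresponds {A} A⊆ {e} e∈ =
    ∈-map⁺ g ,
    (λ m → let e′ , e′∈A , ge≡ = ∈-map⁻ g m in
           subst (_∈ A) (sym (g-injective e∈ (All.lookup A⊆ e′∈A) ge≡)) e′∈A)

  g⁻¹-All-E : ∀ {A} → All InImage A → All E (map g⁻¹ A)
  g⁻¹-All-E A⊆ = Allₚ.map⁺ (All.map (proj₁ ∘ g⁻¹-image) A⊆)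

  g-All-InImage : ∀ {A} → All E A → All InImage (map g A)
  g-All-InImage A⊆ = Allₚ.map⁺ (All.map (λ e∈ → _ , e∈ , refl) A⊆)

  IsMod-pull : ∀ {u} A B → E u → All InImage A → All InImage B →
               ∃[ w ] (E w × IsMod (val₂ (g w)) (val₂ (g u)) A B)
  IsMod-pull {u} A B u∈ A⊆ B⊆ =
    let w , w∈ , m = proj₂ good-E u (map g⁻¹ A) (map g⁻¹ B) u∈ (g⁻¹-All-E A⊆) (g⁻¹-All-E B⊆)
    in w , w∈ , IsMod-transport w∈ u∈ A⊆ B⊆ (g⁻¹-Corresponds A⊆) (g⁻¹-Corresponds B⊆) m

  IsMod-push : ∀ {u v} A B → E u → E v → All E A → All E B → IsMod (Val t₁ v) (Val t₁ u) A B →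
               IsMod (val₂ (g v)) (val₂ (g u)) (map g A) (map g B)
  IsMod-push A B u∈ v∈ A⊆ B⊆ =
    IsMod-transport v∈ u∈ (g-All-InImage A⊆) (g-All-InImage B⊆) (g-Corresponds A⊆) (g-Corresponds B⊆)

  xs₂ ys₂ : List V
  xs₂ = xs ++ [ a ]
  ys₂ = ys ++ [ g a ]

  g-maps-ps : ∀ {p} → p ∈ ps → g (proj₁ p) ≡ proj₂ p
  g-maps-ps p∈ = trans (g-D (base (∈-map⁺ proj₁ p∈))) (All.lookup f₀-maps p∈)

  g-xs₂⊆ys₂ : ∀ {x} → x ∈ xs₂ → g x ∈ ys₂
  g-xs₂⊆ys₂ x∈ with ∈-++⁻ xs x∈
  ... | inj₂ (here refl) = ∈-++⁺ʳ ys (here refl)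
  ... | inj₁ x∈xs with ∈-map⁻ proj₁ x∈xs
  ...   | p , p∈ , refl = ∈-++⁺ˡ (subst (_∈ ys) (sym (g-maps-ps p∈)) (∈-map⁺ proj₂ p∈))

  ys₂⊆image : ∀ {y} → y ∈ ys₂ → InImage y
  ys₂⊆image y∈ with ∈-++⁻ ys y∈
  ... | inj₂ (here refl) = a , a∈E , refl
  ... | inj₁ y∈ys with ∈-map⁻ proj₂ y∈ys
  ...   | p , p∈ , refl = proj₁ p , D⇒E (base (∈-map⁺ proj₁ p∈)) , g-maps-ps p∈

  Δ₂-ys⊆image : ∀ {z} → Δ t₂ ys₂ z → InImage z
  Δ₂-ys⊆image = Δ-ind t₂ ys₂ InImage ys₂⊆image diff-image mod-image
    where
    diff-image : ∀ {u v x} → InImage u → InImage v → Dom t₂ u → Dom t₂ v →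
                 Val t₂ u ∋ x → Val t₂ v x ≡ false → InImage x
    diff-image {x = x} (u₁ , u₁∈ , refl) (v₁ , v₁∈ , refl) _ _ x∈u x∉v with decide (InImage x)
    ... | inj₁ i  = i
    ... | inj₂ ¬i = ⊥-elim (true⇒¬false x∈u
          (trans (val₂-outside-image u₁∈ ¬i) (trans (sym (val₂-outside-image v₁∈ ¬i)) x∉v)))
    mod-image : ∀ {u v} (A B : List V) → InImage u → All InImage A → All InImage B →
                Dom t₂ u → Dom t₂ v → IsMod (Val t₂ v) (Val t₂ u) A B → InImage v
    mod-image {v = v} A B (u₁ , u₁∈ , refl) A⊆ B⊆ _ v∈ m =
      let w , w∈ , m′ = IsMod-pull A B u₁∈ A⊆ B⊆
      in w , w∈ , sym (val₂-injective v (g w) v∈ (dom₂-image (w , w∈ , refl)) (IsMod-unique m m′))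

  E⇒Δ₂-ys : ∀ {e} → E e → Δ t₂ ys₂ (g e)
  E⇒Δ₂-ys e∈ = proj₂ (Δ-ind t₁ xs₂ (λ e → E e × Δ t₂ ys₂ (g e)) base-case diff-case mod-case e∈)
    where
    base-case : ∀ {x} → x ∈ xs₂ → E x × Δ t₂ ys₂ (g x)
    base-case x∈ = base x∈ , base (g-xs₂⊆ys₂ x∈)
    diff-case : ∀ {u v x} → E u × Δ t₂ ys₂ (g u) → E v × Δ t₂ ys₂ (g v) → Dom t₁ u → Dom t₁ v →
                Val t₁ u ∋ x → Val t₁ v x ≡ false → E x × Δ t₂ ys₂ (g x)
    diff-case (u∈ , du) (v∈ , dv) u∈₁ v∈₁ x∈u x∉v =
      let x∈ = diff u∈ v∈ u∈₁ v∈₁ x∈u x∉v in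
      x∈ , diff du dv (dom₂-image (_ , u∈ , refl)) (dom₂-image (_ , v∈ , refl))
                 (trans (val₂-image u∈ x∈) x∈u) (trans (val₂-image v∈ x∈) x∉v)
    mod-case : ∀ {u v} (A B : List V) → E u × Δ t₂ ys₂ (g u) →
               All (λ e → E e × Δ t₂ ys₂ (g e)) A → All (λ e → E e × Δ t₂ ys₂ (g e)) B →
               Dom t₁ u → Dom t₁ v → IsMod (Val t₁ v) (Val t₁ u) A B → E v × Δ t₂ ys₂ (g v)
    mod-case A B (u∈ , du) A⊆ B⊆ u∈₁ v∈₁ m =
      let v∈ = gen A B u∈ (All.map proj₁ A⊆) (All.map proj₁ B⊆) u∈₁ v∈₁ m in
      v∈ , gen (map g A) (map g B) du (Allₚ.map⁺ (All.map proj₂ A⊆)) (Allₚ.map⁺ (All.map proj₂ B⊆))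
               (dom₂-image (_ , u∈ , refl)) (dom₂-image (_ , v∈ , refl))
               (IsMod-push A B u∈ v∈ (All.map proj₁ A⊆) (All.map proj₁ B⊆) m)

  good-xs₂ : Good₁ t₂ xs₂
  good-xs₂ = Good₁-⊑ t₁⊑t₂ good-E

  Δ₂-xs⇒E : ∀ {e} → Δ t₂ xs₂ e → E e
  Δ₂-xs⇒E = Δ-⊑-reflect t₁⊑t₂ good-E

  good-ys₂ : Good₁ t₂ ys₂
  good-ys₂ =
    (λ z d → dom₂-image (Δ₂-ys⊆image d)) ,
    (λ u A B du dA dB →
      let u₁ , u₁∈ , gu₁≡u = Δ₂-ys⊆image du
          w , w∈ , m = IsMod-pull A B u₁∈ (All.map Δ₂-ys⊆image dA) (All.map Δ₂-ys⊆image dB)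
      in g w , E⇒Δ₂-ys w∈ , subst (λ c → IsMod (val₂ (g w)) (val₂ c) A B) gu₁≡u m)

  g-iso : IsIso t₂ xs₂ ys₂ g g⁻¹
  g-iso =
    (λ _ → E⇒Δ₂-ys ∘ Δ₂-xs⇒E) ,
    (λ _ → Δ-⊑ t₁⊑t₂ ∘ proj₁ ∘ g⁻¹-image ∘ Δ₂-ys⊆image) ,
    (λ _ → g⁻¹∘g ∘ Δ₂-xs⇒E) ,
    (λ _ → proj₂ ∘ g⁻¹-image ∘ Δ₂-ys⊆image) ,
    (λ x y dx dy → let x∈ = Δ₂-xs⇒E dx ; y∈ = Δ₂-xs⇒E dy in mk⇔
       (λ (_ , x∈y) → dom₂-image (_ , y∈ , refl) ,
                      trans (val₂-image y∈ x∈) (trans (sym (val₂-old (E⇒dom₁ y∈) x)) x∈y))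
       (λ (_ , gx∈gy) → dom₂-old (E⇒dom₁ y∈) ,
                        trans (val₂-old (E⇒dom₁ y∈) x) (trans (sym (val₂-image y∈ x∈)) gx∈gy)))

  g-maps : All (λ p → g (proj₁ p) ≡ proj₂ p) (ps ++ [ (a , g a) ])
  g-maps = Allₚ.++⁺ (All.tabulate g-maps-ps) (refl ∷ [])

  extension : ∃[ t ] (t₀ ⊑ t × ∃[ b ] Good₂ t (ps ++ [ (a , b) ]))
  extension = t₂ , ⊑-trans {t₀} {t₁} {t₂} t₀⊑t₁ t₁⊑t₂ , g a ,
    subst₂ Good₂-along (sym (Listₚ.map-++ proj₁ ps [ (a , g a) ])) (sym (Listₚ.map-++ proj₂ ps [ (a , g a) ]))
           (good-xs₂ , good-ys₂ , g , g⁻¹ , g-iso , g-maps)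
    where
    Good₂-along : List V → List V → Set
    Good₂-along L₁ L₂ = Good₁ t₂ L₁ × Good₁ t₂ L₂ ×
      ∃[ f ] ∃[ f⁻¹ ] (IsIso t₂ L₁ L₂ f f⁻¹ × All (λ p → f (proj₁ p) ≡ proj₂ p) (ps ++ [ (a , g a) ]))

-- Density

Good₂-extend : ExcludedMiddle 0ℓ → ∀ ps a t₀ → Good₂ t₀ ps →
               ∃[ t ] (t₀ ⊑ t × ∃[ b ] Good₂ t (ps ++ [ (a , b) ]))
Good₂-extend em [] a t₀ _ =
  t , s⊑t , a , good , good , id , id ,
  ((λ _ d → d) , (λ _ d → d) , (λ _ _ → refl) , (λ _ _ → refl) , (λ _ _ _ _ → mk⇔ id id)) , refl ∷ []
  where
  open ClosedExtension (ClosedExtensionConstruction.closedExtension em t₀ a)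
  good : Good₁ t (a ∷ [])
  good = Closed⇒Good₁ closed λ { (here refl) → a∈dom }
Good₂-extend em ((x₀ , y₀) ∷ ps′) a t₀ good = CopyExtension.extension em x₀ y₀ ps′ a t₀ good

𝒢-dense : ExcludedMiddle 0ℓ → ∀ ps a → Dense (𝒢 ps a)
𝒢-dense em ps a s with em {∃[ t ] (s ⊑ t × Good₂ t ps)}
... | no ¬ext = s , ⊑-refl s , inj₂ ¬ext
... | yes (t₀ , s⊑t₀ , good) =
      let t , t₀⊑t , b , good′ = Good₂-extend em ps a t₀ good
      in t , ⊑-trans {s} {t₀} {t} s⊑t₀ t₀⊑t , inj₁ (b , good′)

lemma7 : ExcludedMiddle 0ℓ →
    (Σ[ e ∈ (ℕ → Pred Cond 0ℓ) ]
       ((∀ n → ∃[ ps ] ∃[ a ] (e n ≐ 𝒢 ps a)) ×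
        (∀ (ps : List (V × V)) (a : V) → ∃[ n ] (e n ≐ 𝒢 ps a)))) ×
    (∀ (ps : List (V × V)) (a : V) → Dense (𝒢 ps a))
lemma7 em = 𝒢-countable , 𝒢-dense em
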